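{- Let $G_1$ and $G_2$ be two vertex-disjoint 2-edge-colored simple graphs with Hamiltonian alternating cycles $C_1=x_0x_1\cdots x_{2n-1}x_0$ and $C_2=y_0y_1\cdots y_{2m-1}y_0$, respectively, and let $G\in G_1\oplus G_2$. Suppose there is no good pair in $G$, and for each $i\in\{1,2\}$ the cycle $C_i$ contains a vertex which is non-singular with respect to $C_{3-i}$. Let $m_1=\min\{n,m\}$ and $M_2=\max\{n,m\}$. Then for each vertex $v\in V(G)$ and each even integer $\ell\in[4,4m_1]\cup[2M_2,2n+2m]$, there is an alternating cycle of length $\ell$ in $G$ passing through $v$.
   Context: All graphs are simple and 2-edge-colored with colors red and blue. An alternating path/cycle is one in which any two consecutive edges have different colors; a Hamiltonian alternating cycle is an alternating cycle through all vertices of the graph. For vertex-disjoint 2-edge-colored graphs $G_1,G_2$, the colored generalized sum $G_1\oplus G_2$ is the set of 2-edge-colored graphs $G$ with $V(G)=V(G_1)\cup V(G_2)$, $G\langle V(G_i)\rangle$ equal to $G_i$ with its coloring for $i=1,2$, and exactly one edge (of arbitrary fixed color) between every $u\in V(G_1)$ and $w\in V(G_2)$; these latter edges are called exterior. For a vertex $v$ of an alternating cycle $C$, $v^r$ (resp. $v^b$) denotes the vertex of $C$ such that $vv^r\in E(C)$ is red (resp. $vv^b\in E(C)$ is blue). For an edge $vw$ with $v\in V(C_1)$, $w\in V(C_2)$: if $vw$ is red, the pair $vw, v^rw^r$ is a good pair if $v^rw^r$ is red; if $vw$ is blue, the pair $vw,v^bw^b$ is a good pair if $v^bw^b$ is blue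 (here $v^r,v^b$ are taken in $C_1$ and $w^r,w^b$ in $C_2$). A vertex $v\in V(C_i)$ is red-singular (resp. blue-singular) with respect to $C_{3-i}$ if all edges $vu$ with $u\in V(C_{3-i})$ are red (resp. blue); singular means red- or blue-singular, and non-singular means not singular. For integers $a\le b$, $[a,b]=\{a,a+1,\ldots,b\}$. -}

module Defs where

open import Data.Nat using (ℕ; zero; suc; _+_; _*_; _≤_; _<_; pred)
open import Data.Maybe using (Maybe; just; nothing)
open import Data.Sum using (_⊎_; inj₁; inj₂)
open import Data.Product using (Σ; ∃; _×_; _,_)
open import Data.Empty using (⊥)
open import Relation.Nullary using (¬_)
open import Relation.Binary.PropositionalEquality using (_≡_)

data Color : Set where
  red blue : Color

flipC : Color → Color
flipC red  = blue
flipC blue = red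

-- A 2-edge-coloured graph on vertex type V is given by
--   col u v = nothing   (no edge uv)   or   just c  (edge uv of colour c).
Coloring : Set → Set
Coloring V = V → V → Maybe Color

record IsSimple {V : Set} (col : Coloring V) : Set where
  field
    symm    : ∀ u v → col u v ≡ col v u
    noLoops : ∀ v → col v v ≡ nothing

-- An alternating cycle of length ℓ, given as an ℓ-periodic sequence
-- w 0, w 1, ..., w (ℓ-1), w ℓ = w 0, ... of pairwise distinct vertices
-- (ℓ ≥ 3), consecutive vertices adjacent, consecutive edges of
-- different colours (also around the closing vertex, by periodicity).
record AltCycle {V : Set} (col : Coloring V) (ℓ : ℕ) (w : ℕ → V) : Set where
  field
    long     : 3 ≤ ℓ
    periodic : ∀ i → w (i + ℓ) ≡ w i
    distinct : ∀ i j → i < ℓ → j < ℓ → w i ≡ w j → i ≡ j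
    alt      : ∀ i → Σ Color λ c →
                 (col (w i) (w (suc i)) ≡ just c)
                 × (col (w (suc i)) (w (suc (suc i))) ≡ just (flipC c))

record HamAltCycle {V : Set} (col : Coloring V) (ℓ : ℕ) (w : ℕ → V) : Set where
  field
    cycle  : AltCycle col ℓ w
    covers : ∀ v → ∃ λ i → (i < ℓ) × (w i ≡ v)

PassesThrough : {V : Set} → (ℕ → V) → V → Set
PassesThrough w v = ∃ λ i → w i ≡ v

-- For the vertex w i of a cycle w of length ℓ: its c-neighbour on the
-- cycle (w i)^c, i.e. the cycle neighbour joined to w i by the cycle
-- edge of colour c.  The two cycle neighbours are w (i+1) and
-- w (i + ℓ - 1) = w (i-1).
nbr : {V : Set} → Color → Coloring V → ℕ → (ℕ → V) → ℕ → V
nbr {V} c col ℓ w i = pick (col (w i) (w (suc i))) c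
  where
  pick : Maybe Color → Color → V
  pick (just red)  red  = w (suc i)
  pick (just blue) blue = w (suc i)
  pick _ _              = w (i + pred ℓ)

-- The colored generalized sum: G ∈ G₁ ⊕ G₂ is determined by the
-- colourings of G₁, G₂ and the colour ext u w of the exterior edge uw.
sumCol : {V₁ V₂ : Set} → Coloring V₁ → Coloring V₂ → (V₁ → V₂ → Color)
       → Coloring (V₁ ⊎ V₂)
sumCol col₁ col₂ ext (inj₁ u) (inj₁ v) = col₁ u v
sumCol col₁ col₂ ext (inj₂ u) (inj₂ v) = col₂ u v
sumCol col₁ col₂ ext (inj₁ u) (inj₂ w) = just (ext u w)
sumCol col₁ col₂ ext (inj₂ w) (inj₁ u) = just (ext u w)

NoGoodPair : {V₁ V₂ : Set} → Coloring V₁ → Coloring V₂ → (V₁ → V₂ → Color)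
           → ℕ → (ℕ → V₁) → ℕ → (ℕ → V₂) → Set
NoGoodPair col₁ col₂ ext ℓ₁ x ℓ₂ y =
  ∀ i j c → ext (x i) (y j) ≡ c
          → ext (nbr c col₁ ℓ₁ x i) (nbr c col₂ ℓ₂ y j) ≡ c → ⊥

NonSingular : {A B : Set} → (A → B → Color) → A → Set
NonSingular e v = ¬ (∀ u → e v u ≡ red) × ¬ (∀ u → e v u ≡ blue)

-- Read the cycles as x i (i mod 2n) and y j (j mod 2m) and measure the colour of the
-- exterior edge x i y j against the cycle edge x i x (i+1).  Without good pairs the
-- exterior colouring is rigid: along equally coloured cycle edges x i x (i+1) and
-- y j y (j+1) the exterior edges form alternating 4-cycles (a double step along both
-- cycles preserves exterior colours, and as going round both cycles is a sequence of
-- such steps, they can be undone).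
-- Hence on "opposed" pairs, whose cycle edges x i x (i+1), y j y (j+1) differ in
-- colour, the relative colour depends only on i + j; call it diag (i + j).  It has
-- periods 2n and 2m, and non-singularity makes it non-constant (after traversing
-- the second cycle backwards if necessary), so it turns from red to blue and back
-- within one period.  A red diagonal lets an x-arc continue alternatingly into a
-- y-arc and a blue one lets a y-arc continue into an x-arc: two arcs give the cycles
-- of length below 2n + 2m, four arcs through both colour changes a Hamiltonian one,
-- and shifting the arcs by whole periods puts any given vertex on the cycle.

module Submission where

open import Defs
open import Data.Nat
open import Data.Nat.Properties
open import Data.Nat.DivMod
open import Data.Nat.Divisibility using (_∣_; divides)
open import Data.Nat.Tactic.RingSolver
open import Data.Maybe using (just)
open import Data.Maybe.Properties using (just-injective)
open import Data.Sum using (_⊎_; inj₁; inj₂; swap)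
open import Data.Sum.Properties using (inj₁-injective; inj₂-injective; swap-involutive)
open import Data.Product using (Σ; ∃; _×_; _,_; proj₁; proj₂)
open import Data.Empty using (⊥-elim)
open import Relation.Nullary using (¬_; yes; no)
open import Relation.Binary.PropositionalEquality

flipC-involutive : ∀ c → flipC (flipC c) ≡ c
flipC-involutive red  = refl
flipC-involutive blue = refl

flipC-injective : ∀ {a b} → flipC a ≡ flipC b → a ≡ b
flipC-injective {a} {b} e = trans (sym (flipC-involutive a)) (trans (cong flipC e) (flipC-involutive b))

flipC-≢ : ∀ c → flipC c ≢ c
flipC-≢ red  ()
flipC-≢ blue ()

≡-or-≡flipC : ∀ a c → a ≡ c ⊎ a ≡ flipC c
≡-or-≡flipC red  red  = inj₁ refl
≡-or-≡flipC red  blue = inj₂ refl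
≡-or-≡flipC blue red  = inj₂ refl
≡-or-≡flipC blue blue = inj₁ refl

≢⇒≡flipC : ∀ {a b} → a ≢ b → a ≡ flipC b
≢⇒≡flipC {a} {b} a≢b with ≡-or-≡flipC a b
... | inj₁ a≡b  = ⊥-elim (a≢b a≡b)
... | inj₂ a≡b′ = a≡b′

flips : ℕ → Color → Color
flips zero    c = c
flips (suc t) c = flipC (flips t c)

flips-flipC : ∀ t c → flips t (flipC c) ≡ flipC (flips t c)
flips-flipC zero    c = refl
flips-flipC (suc t) c = cong flipC (flips-flipC t c)

flips-+ : ∀ a b c → flips (a + b) c ≡ flips b (flips a c)
flips-+ zero    b c = refl
flips-+ (suc a) b c = trans (cong flipC (flips-+ a b c)) (sym (flips-flipC b (flips a c)))

flips-+-≡ : ∀ s t a b → b ≡ flips s a → flips (s + t) a ≡ flips t b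
flips-+-≡ s t a b b≡ = trans (flips-+ s t a) (cong (flips t) (sym b≡))

flips-pred : ∀ q a b → a ≡ flips (suc q) b → flips q b ≡ flipC a
flips-pred q a b a≡ = trans (sym (flipC-involutive _)) (cong flipC (sym a≡))

flips-even : ∀ k c → flips (2 * k) c ≡ c
flips-even zero    c = refl
flips-even (suc k) c = begin
    flips (2 * suc k) c               ≡⟨ cong (λ t → flips t c) (*-suc 2 k) ⟩
    flipC (flipC (flips (2 * k) c))   ≡⟨ flipC-involutive _ ⟩
    flips (2 * k) c                   ≡⟨ flips-even k c ⟩
    c                                 ∎
  where open ≡-Reasoning

flips-fixed⇒even : ∀ d c → flips d c ≡ c → ∃ λ k → d ≡ 2 * k
flips-fixed⇒even d c = proj₁ (flipsParity d)
  where
  flipsParity : ∀ d → (flips d c ≡ c → ∃ λ k → d ≡ 2 * k) × (flips d c ≡ flipC c → ∃ λ k → d ≡ suc (2 * k))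
  flipsParity zero    = (λ _ → 0 , refl) , (λ e → ⊥-elim (flipC-≢ c (sym e)))
  flipsParity (suc d) =
      (λ e → let (k , d≡) = proj₂ (flipsParity d) (flipC-injective (trans e (sym (flipC-involutive c))))
             in suc k , trans (cong suc d≡) (sym (+-suc (suc k) (k + 0))))
    , (λ e → let (k , d≡) = proj₁ (flipsParity d) (flipC-injective e) in k , cong suc d≡)

relColor : Color → Color → Color
relColor red  red  = red
relColor blue blue = red
relColor red  blue = blue
relColor blue red  = blue

relColor-flipC-flipC : ∀ a b → relColor (flipC a) (flipC b) ≡ relColor a b
relColor-flipC-flipC red  red  = refl
relColor-flipC-flipC red  blue = refl
relColor-flipC-flipC blue red  = refl
relColor-flipC-flipC blue blue = refl

relColor-flipCʳ : ∀ a b → relColor a (flipC b) ≡ flipC (relColor a b)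
relColor-flipCʳ red  red  = refl
relColor-flipCʳ red  blue = refl
relColor-flipCʳ blue red  = refl
relColor-flipCʳ blue blue = refl

relColor-red⇒≡ : ∀ a b → relColor a b ≡ red → a ≡ b
relColor-red⇒≡ red  red  _ = refl
relColor-red⇒≡ blue blue _ = refl
relColor-red⇒≡ red  blue ()
relColor-red⇒≡ blue red  ()

relColor-blue⇒≡flipC : ∀ a b → relColor a b ≡ blue → a ≡ flipC b
relColor-blue⇒≡flipC red  blue _ = refl
relColor-blue⇒≡flipC blue red  _ = refl
relColor-blue⇒≡flipC red  red  ()
relColor-blue⇒≡flipC blue blue ()

relColor-injectiveˡ : ∀ a b c → relColor a c ≡ relColor b c → a ≡ b
relColor-injectiveˡ red  red  c    _  = refl
relColor-injectiveˡ blue blue c    _  = refl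
relColor-injectiveˡ red  blue red  ()
relColor-injectiveˡ red  blue blue ()
relColor-injectiveˡ blue red  red  ()
relColor-injectiveˡ blue red  blue ()

colorChange : ∀ (f : ℕ → Color) c k → f 0 ≡ c → f k ≡ flipC c →
              ∃ λ t → t < k × f t ≡ c × f (suc t) ≡ flipC c
colorChange f c zero    f0 fk = ⊥-elim (flipC-≢ c (trans (sym fk) f0))
colorChange f c (suc k) f0 fk with ≡-or-≡flipC (f k) c
... | inj₁ fk′ = k , ≤-refl , fk′ , fk
... | inj₂ fk′ = let (t , t<k , ft , fst) = colorChange f c k f0 fk′ in t , m<n⇒m<1+n t<k , ft , fst

constant-or-flipC : ∀ (f : ℕ → Color) c k → (∀ j → j < k → f j ≡ c) ⊎ ∃ λ j → f j ≡ flipC c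
constant-or-flipC f c zero = inj₁ (λ _ ())
constant-or-flipC f c (suc k) with constant-or-flipC f c k | ≡-or-≡flipC (f k) c
... | inj₂ w        | _       = inj₂ w
... | inj₁ _        | inj₂ fk = inj₂ (k , fk)
... | inj₁ below-k  | inj₁ fk = inj₁ below-suc-k
  where
  below-suc-k : ∀ j → j < suc k → f j ≡ c
  below-suc-k j j< with m≤n⇒m<n∨m≡n (s≤s⁻¹ j<)
  ... | inj₁ j<k  = below-k j j<k
  ... | inj₂ refl = fk

[a+t]%N-cancel : ∀ N .{{_ : NonZero N}} a t → t < N → ((a + t) % N + (N ∸ a % N)) % N ≡ t
[a+t]%N-cancel N a t t<N = begin
    ((a + t) % N + (N ∸ r)) % N            ≡⟨ cong (λ z → (z + (N ∸ r)) % N) (%-distribˡ-+ a t N) ⟩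
    ((r + t % N) % N + (N ∸ r)) % N        ≡⟨ cong (λ z → ((r + z) % N + (N ∸ r)) % N) (m<n⇒m%n≡m t<N) ⟩
    ((r + t) % N + (N ∸ r)) % N            ≡⟨ %-distribˡ-+ ((r + t) % N) (N ∸ r) N ⟩
    ((r + t) % N % N + (N ∸ r) % N) % N    ≡⟨ cong (λ z → (z + (N ∸ r) % N) % N) (m%n%n≡m%n (r + t) N) ⟩
    ((r + t) % N + (N ∸ r) % N) % N        ≡⟨ sym (%-distribˡ-+ (r + t) (N ∸ r) N) ⟩
    (r + t + (N ∸ r)) % N                  ≡⟨ cong (_% N) r+t+[N∸r]≡t+N ⟩
    (t + N) % N                            ≡⟨ [m+n]%n≡m%n t N ⟩
    t % N                                  ≡⟨ m<n⇒m%n≡m t<N ⟩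
    t                                      ∎
  where
  open ≡-Reasoning
  r : ℕ
  r = a % N
  r+t+[N∸r]≡t+N : r + t + (N ∸ r) ≡ t + N
  r+t+[N∸r]≡t+N = begin
    r + t + (N ∸ r)    ≡⟨ cong (_+ (N ∸ r)) (+-comm r t) ⟩
    t + r + (N ∸ r)    ≡⟨ +-assoc t r (N ∸ r) ⟩
    t + (r + (N ∸ r))  ≡⟨ cong (t +_) (m+[n∸m]≡n (m%n≤n a N)) ⟩
    t + N              ∎

[a+t]%N-injective : ∀ N .{{_ : NonZero N}} a t₁ t₂ → t₁ < N → t₂ < N →
                    (a + t₁) % N ≡ (a + t₂) % N → t₁ ≡ t₂
[a+t]%N-injective N a t₁ t₂ t₁<N t₂<N e = begin
  t₁                                 ≡⟨ sym ([a+t]%N-cancel N a t₁ t₁<N) ⟩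
  ((a + t₁) % N + (N ∸ a % N)) % N   ≡⟨ cong (λ z → (z + (N ∸ a % N)) % N) e ⟩
  ((a + t₂) % N + (N ∸ a % N)) % N   ≡⟨ [a+t]%N-cancel N a t₂ t₂<N ⟩
  t₂                                 ∎
  where open ≡-Reasoning

module Periodic {A : Set} (N : ℕ) (z : ℕ → A) (per : ∀ i → z (i + N) ≡ z i) where

  periodic-* : ∀ i k → z (i + k * N) ≡ z i
  periodic-* i zero    = cong z (+-identityʳ i)
  periodic-* i (suc k) = begin
    z (i + (N + k * N))  ≡⟨ cong z (trans (cong (i +_) (+-comm N (k * N))) (sym (+-assoc i (k * N) N))) ⟩
    z (i + k * N + N)    ≡⟨ per (i + k * N) ⟩
    z (i + k * N)        ≡⟨ periodic-* i k ⟩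
    z i                  ∎
    where open ≡-Reasoning

  periodic-% : .{{_ : NonZero N}} → ∀ i → z i ≡ z (i % N)
  periodic-% i = trans (cong z (m≡m%n+[m/n]*n i N)) (periodic-* (i % N) (i / N))

  module Distinct .{{_ : NonZero N}} (dist : ∀ i j → i < N → j < N → z i ≡ z j → i ≡ j) where

    ≡⇒%-≡ : ∀ i j → z i ≡ z j → i % N ≡ j % N
    ≡⇒%-≡ i j e = dist (i % N) (j % N) (m%n<n i N) (m%n<n j N)
                    (trans (sym (periodic-% i)) (trans e (periodic-% j)))

    +-injective : ∀ a t₁ t₂ → t₁ < N → t₂ < N → z (a + t₁) ≡ z (a + t₂) → t₁ ≡ t₂
    +-injective a t₁ t₂ t₁<N t₂<N e = [a+t]%N-injective N a t₁ t₂ t₁<N t₂<N (≡⇒%-≡ (a + t₁) (a + t₂) e)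

Alternating : (ℕ → Color) → Set
Alternating κ = ∀ i → κ (suc i) ≡ flipC (κ i)

alternating-+ : ∀ {κ} → Alternating κ → ∀ i t → κ (i + t) ≡ flips t (κ i)
alternating-+ {κ} alt i zero    = cong κ (+-identityʳ i)
alternating-+ {κ} alt i (suc t) = trans (cong κ (+-suc i t)) (trans (alt (i + t)) (cong flipC (alternating-+ alt i t)))

alternating-even : ∀ {κ} → Alternating κ → ∀ i k → κ (i + 2 * k) ≡ κ i
alternating-even {κ} alt i k = trans (alternating-+ alt i (2 * k)) (flips-even k (κ i))

module Paths {V : Set} (col : Coloring V) where

  AltPath : ℕ → (ℕ → V) → Color → Set
  AltPath n P c = ∀ t → t < n → col (P t) (P (suc t)) ≡ just (flips t c)

  InjectiveUpTo : ℕ → (ℕ → V) → Set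
  InjectiveUpTo n P = ∀ i j → i ≤ n → j ≤ n → P i ≡ P j → i ≡ j

  append : ℕ → (ℕ → V) → (ℕ → V) → ℕ → V
  append p P Q t with t ≤? p
  ... | yes _ = P t
  ... | no _  = Q (t ∸ suc p)

  append-≤ : ∀ p P Q t → t ≤ p → append p P Q t ≡ P t
  append-≤ p P Q t t≤p with t ≤? p
  ... | yes _  = refl
  ... | no t≰p = ⊥-elim (t≰p t≤p)

  append-suc+ : ∀ p P Q j → append p P Q (suc p + j) ≡ Q j
  append-suc+ p P Q j with suc p + j ≤? p
  ... | yes h = ⊥-elim (<-irrefl refl (≤-trans (s≤s (m≤m+n p j)) h))
  ... | no _  = cong Q (m+n∸m≡n (suc p) j)

  append-suc : ∀ p P Q → append p P Q (suc p) ≡ Q 0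
  append-suc p P Q = trans (cong (append p P Q) (sym (+-identityʳ (suc p)))) (append-suc+ p P Q 0)

  ≤-or-suc+ : ∀ p t → t ≤ p ⊎ ∃ λ j → t ≡ suc p + j
  ≤-or-suc+ p t with t ≤? p
  ... | yes t≤p = inj₁ t≤p
  ... | no t≰p  = inj₂ (t ∸ suc p , sym (m+[n∸m]≡n (≰⇒> t≰p)))

  altPath-append : ∀ p q P Q c → AltPath p P c → AltPath q Q (flips (suc p) c) →
                   col (P p) (Q 0) ≡ just (flips p c) → AltPath (suc p + q) (append p P Q) c
  altPath-append p q P Q c pathP pathQ joint t t< with ≤-or-suc+ p t
  ... | inj₁ t≤p with m≤n⇒m<n∨m≡n t≤p
  ...   | inj₁ t<p rewrite append-≤ p P Q t t≤p | append-≤ p P Q (suc t) t<p = pathP t t<p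
  ...   | inj₂ refl =
          subst₂ (λ a b → col a b ≡ just (flips p c))
                 (sym (append-≤ p P Q p ≤-refl)) (sym (append-suc p P Q)) joint
  altPath-append p q P Q c pathP pathQ joint t t< | inj₂ (j , refl) =
    subst₂ (λ a b → col a b ≡ just (flips (suc p + j) c))
           (sym (append-suc+ p P Q j))
           (sym (trans (cong (append p P Q) (sym (+-suc (suc p) j))) (append-suc+ p P Q (suc j))))
           (trans (pathQ j (+-cancelˡ-≤ (suc p) _ _ (subst (_≤ suc p + q) (sym (+-suc (suc p) j)) t<)))
                  (cong just (sym (flips-+ (suc p) j c))))

  injectiveUpTo-append : ∀ p q P Q → InjectiveUpTo p P → InjectiveUpTo q Q →
                         (∀ i j → i ≤ p → j ≤ q → P i ≢ Q j) →
                         InjectiveUpTo (suc p + q) (append p P Q)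
  injectiveUpTo-append p q P Q injP injQ disjoint i j i≤ j≤ e with ≤-or-suc+ p i | ≤-or-suc+ p j
  ... | inj₁ i≤p | inj₁ j≤p
    rewrite append-≤ p P Q i i≤p | append-≤ p P Q j j≤p = injP i j i≤p j≤p e
  ... | inj₁ i≤p | inj₂ (j′ , refl)
    rewrite append-≤ p P Q i i≤p | append-suc+ p P Q j′ =
      ⊥-elim (disjoint i j′ i≤p (+-cancelˡ-≤ (suc p) _ _ j≤) e)
  ... | inj₂ (i′ , refl) | inj₁ j≤p
    rewrite append-≤ p P Q j j≤p | append-suc+ p P Q i′ =
      ⊥-elim (disjoint j i′ j≤p (+-cancelˡ-≤ (suc p) _ _ i≤) (sym e))
  ... | inj₂ (i′ , refl) | inj₂ (j′ , refl)
    rewrite append-suc+ p P Q i′ | append-suc+ p P Q j′ =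
      cong (suc p +_) (injQ i′ j′ (+-cancelˡ-≤ (suc p) _ _ i≤) (+-cancelˡ-≤ (suc p) _ _ j≤) e)

  append-≢ : ∀ p q P Q v → (∀ j → j ≤ p → v ≢ P j) → (∀ j → j ≤ q → v ≢ Q j) →
             ∀ j → j ≤ suc p + q → v ≢ append p P Q j
  append-≢ p q P Q v v≢P v≢Q j j≤ with ≤-or-suc+ p j
  ... | inj₁ j≤p rewrite append-≤ p P Q j j≤p = v≢P j j≤p
  ... | inj₂ (j′ , refl) rewrite append-suc+ p P Q j′ = v≢Q j′ (+-cancelˡ-≤ (suc p) _ _ j≤)

  private
    suc-% : ∀ L k → suc k % suc L ≡ suc (k % suc L) % suc L
    suc-% L k = trans (cong (λ z → suc z % suc L) (m≡m%n+[m/n]*n k (suc L)))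
                      ([m+kn]%n≡m%n (suc (k % suc L)) (k / suc L) (suc L))

    suc-%-cases : ∀ L k → (k % suc L < L × suc k % suc L ≡ suc (k % suc L))
                        ⊎ (k % suc L ≡ L × suc k % suc L ≡ 0)
    suc-%-cases L k with m≤n⇒m<n∨m≡n (s≤s⁻¹ (m%n<n k (suc L)))
    ... | inj₁ lt = inj₁ (lt , trans (suc-% L k) (m<n⇒m%n≡m (s≤s lt)))
    ... | inj₂ eq = inj₂ (eq , trans (suc-% L k) (trans (cong (λ z → suc z % suc L) eq) (n%n≡0 (suc L))))

  altCycle-close : ∀ L W c → AltPath L W c → col (W L) (W 0) ≡ just (flips L c) →
                   flips (suc L) c ≡ c → InjectiveUpTo L W → 2 ≤ L →
                   AltCycle col (suc L) (λ k → W (k % suc L))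
  altCycle-close L W c path closing parity inj 2≤L = record
    { long     = s≤s 2≤L
    ; periodic = λ i → cong W ([m+n]%n≡m%n i (suc L))
    ; distinct = λ i j i< j< e → trans (sym (m<n⇒m%n≡m i<)) (trans
        (inj (i % suc L) (j % suc L) (s≤s⁻¹ (m%n<n i (suc L))) (s≤s⁻¹ (m%n<n j (suc L))) e)
        (m<n⇒m%n≡m j<))
    ; alt      = λ i → flips (i % suc L) c , edge i , trans (edge (suc i)) (cong just (next i))
    }
    where
    edge : ∀ k → col (W (k % suc L)) (W (suc k % suc L)) ≡ just (flips (k % suc L) c)
    edge k with suc-%-cases L k
    ... | inj₁ (lt , e)  rewrite e = path (k % suc L) lt
    ... | inj₂ (eq′ , e) rewrite e | eq′ = closing
    next : ∀ k → flips (suc k % suc L) c ≡ flipC (flips (k % suc L) c)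
    next k with suc-%-cases L k
    ... | inj₁ (lt , e)  rewrite e = refl
    ... | inj₂ (eq′ , e) rewrite e | eq′ = sym parity

nbr-forward : ∀ {V : Set} (col : Coloring V) ℓ (w : ℕ → V) i c →
              col (w i) (w (suc i)) ≡ just c → nbr c col ℓ w i ≡ w (suc i)
nbr-forward col ℓ w i red  e rewrite e = refl
nbr-forward col ℓ w i blue e rewrite e = refl

nbr-backward : ∀ {V : Set} (col : Coloring V) ℓ (w : ℕ → V) i c →
               col (w i) (w (suc i)) ≡ just (flipC c) → nbr c col ℓ w i ≡ w (i + pred ℓ)
nbr-backward col ℓ w i red  e rewrite e = refl
nbr-backward col ℓ w i blue e rewrite e = refl

-- Step c i s: leaving z i by its c-edge and then taking the next cycle edge
-- (of colour flipC c) leads to z (i + s), where s is 2 or P + P ≡ -2 (mod 2N).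
module DoubleMoves {V : Set} (col : Coloring V) (N : ℕ) (N≥2 : 2 ≤ N) (z : ℕ → V)
  (per : ∀ i → z (i + 2 * N) ≡ z i) (κ : ℕ → Color)
  (colZ : ∀ i → col (z i) (z (suc i)) ≡ just (κ i)) (κ-alt : Alternating κ) where

  P : ℕ
  P = pred (2 * N)

  private
    suc-pred-2* : ∀ N → 2 ≤ N → suc (pred (2 * N)) ≡ 2 * N
    suc-pred-2* (suc _) _ = refl

    suc-P : suc P ≡ 2 * N
    suc-P = suc-pred-2* N N≥2

  z-suc-+P : ∀ i → z (suc (i + P)) ≡ z i
  z-suc-+P i = trans (cong z (trans (sym (+-suc i P)) (cong (i +_) suc-P))) (per i)

  κ-periodic : ∀ i → κ (i + 2 * N) ≡ κ i
  κ-periodic i = just-injective (trans (sym (colZ (i + 2 * N))) (trans (cong₂ col (per i) (per (suc i))) (colZ i)))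

  κ-+P : ∀ i → κ (i + P) ≡ flipC (κ i)
  κ-+P i = flipC-injective (trans (sym (κ-alt (i + P)))
             (trans (cong κ (trans (sym (+-suc i P)) (cong (i +_) suc-P))) (trans (κ-periodic i) (sym (flipC-involutive (κ i))))))

  Step : Color → ℕ → ℕ → Set
  Step c i s = (κ i ≡ c × s ≡ 2) ⊎ (κ i ≡ flipC c × s ≡ P + P)

  step-+ : ∀ c i s → Step c i s → Step c (i + s) s
  step-+ c i s (inj₁ (e , refl)) =
    inj₁ (trans (cong κ (+-comm i 2)) (trans (κ-alt (suc i)) (trans (cong flipC (κ-alt i)) (trans (flipC-involutive _) e))) , refl)
  step-+ c i s (inj₂ (e , refl)) =
    inj₂ (trans (cong κ (sym (+-assoc i P P)))
                (trans (κ-+P (i + P)) (trans (cong flipC (κ-+P i)) (trans (flipC-involutive _) e))) , refl)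

  step-+* : ∀ c i s k → Step c i s → Step c (i + k * s) s
  step-+* c i s zero    st = subst (λ j → Step c j s) (sym (+-identityʳ i)) st
  step-+* c i s (suc k) st = subst (λ j → Step c j s) (shift i k s) (step-+ c (i + k * s) s (step-+* c i s k st))
    where
    shift : ∀ i k s → i + k * s + s ≡ i + suc k * s
    shift = solve-∀

  doubleMove : ∀ c i s → Step c i s →
               Σ ℕ λ i₁ → (nbr c col (2 * N) z i ≡ z i₁) × (nbr (flipC c) col (2 * N) z i₁ ≡ z (i + s))
  doubleMove c i s (inj₁ (e , refl)) =
    suc i , nbr-forward col (2 * N) z i c (trans (colZ i) (cong just e)) ,
    trans (nbr-forward col (2 * N) z (suc i) (flipC c) (trans (colZ (suc i)) (cong just (trans (κ-alt i) (cong flipC e)))))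
          (cong z (+-comm 2 i))
  doubleMove c i s (inj₂ (e , refl)) =
    i + P , nbr-backward col (2 * N) z i c (trans (colZ i) (cong just e)) ,
    trans (nbr-backward col (2 * N) z (i + P) (flipC c) (trans (colZ (i + P)) (cong just (trans (κ-+P i) (cong flipC e)))))
          (cong z (+-assoc i P P))

  open Periodic (2 * N) z per using (periodic-*)

  step-return : ∀ i s M → (∃ λ c → Step c i s) → z (i + N * M * s) ≡ z i
  step-return i s M (_ , inj₁ (_ , refl)) = trans (cong z (cong (i +_) (NM2 N M))) (periodic-* i M)
    where
    NM2 : ∀ N M → N * M * 2 ≡ M * (2 * N)
    NM2 = solve-∀
  step-return i s M (_ , inj₂ (_ , refl)) = trans (cong z (cong (i +_) (NMPP N M P))) (periodic-* i (M * P))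
    where
    NMPP : ∀ N M P → N * M * (P + P) ≡ (M * P) * (2 * N)
    NMPP = solve-∀

record CyclePair {V₁ V₂ : Set} (col₁ : Coloring V₁) (col₂ : Coloring V₂) : Set where
  field
    n m    : ℕ
    n≥2    : 2 ≤ n
    m≥2    : 2 ≤ m
    x      : ℕ → V₁
    y      : ℕ → V₂
    perX   : ∀ i → x (i + 2 * n) ≡ x i
    perY   : ∀ j → y (j + 2 * m) ≡ y j
    distX  : ∀ i j → i < 2 * n → j < 2 * n → x i ≡ x j → i ≡ j
    distY  : ∀ i j → i < 2 * m → j < 2 * m → y i ≡ y j → i ≡ j
    κx κy  : ℕ → Color
    colX   : ∀ i → col₁ (x i) (x (suc i)) ≡ just (κx i)
    colY   : ∀ j → col₂ (y j) (y (suc j)) ≡ just (κy j)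
    κx-alt : Alternating κx
    κy-alt : Alternating κy
    covX   : ∀ u → ∃ λ i → x i ≡ u
    covY   : ∀ w → ∃ λ j → y j ≡ w

Rigid : {V₁ V₂ : Set} {col₁ : Coloring V₁} {col₂ : Coloring V₂} →
        CyclePair col₁ col₂ → (V₁ → V₂ → Color) → Set
Rigid C ext = ∀ i j → κx i ≡ κy j →
                (ext (x (suc i)) (y (suc j)) ≡ flipC (ext (x i) (y j)))
              × (ext (x (suc i)) (y j) ≡ flipC (ext (x i) (y (suc j))))
  where open CyclePair C

hamAltCycles⇒cyclePair : {V₁ V₂ : Set} (col₁ : Coloring V₁) (col₂ : Coloring V₂) (n m : ℕ)
                         (x : ℕ → V₁) (y : ℕ → V₂) →
                         HamAltCycle col₁ (2 * n) x → HamAltCycle col₂ (2 * m) y →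
                         Σ (CyclePair col₁ col₂) λ C → CyclePair.n C ≡ n × CyclePair.m C ≡ m
                                                       × CyclePair.x C ≡ x × CyclePair.y C ≡ y
hamAltCycles⇒cyclePair col₁ col₂ n m x y H₁ H₂ = C , refl , refl , refl , refl
  where
  module C₁ = AltCycle (HamAltCycle.cycle H₁)
  module C₂ = AltCycle (HamAltCycle.cycle H₂)
  half≥2 : ∀ k → 3 ≤ 2 * k → 2 ≤ k
  half≥2 (suc (suc _)) _ = s≤s (s≤s z≤n)
  half≥2 (suc zero) (s≤s (s≤s ()))
  alt-colors : ∀ {V} {col : Coloring V} {ℓ} {w} (A : AltCycle col ℓ w) →
               Σ (ℕ → Color) λ κ → (∀ i → col (w i) (w (suc i)) ≡ just (κ i)) × Alternating κ
  alt-colors A = (λ i → proj₁ (alt i)) , (λ i → proj₁ (proj₂ (alt i))) ,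
                 (λ i → just-injective (trans (sym (proj₁ (proj₂ (alt (suc i))))) (proj₂ (proj₂ (alt i)))))
    where open AltCycle A
  C : CyclePair col₁ col₂
  C = record
    { n = n ; m = m ; n≥2 = half≥2 n C₁.long ; m≥2 = half≥2 m C₂.long ; x = x ; y = y
    ; perX = C₁.periodic ; perY = C₂.periodic ; distX = C₁.distinct ; distY = C₂.distinct
    ; κx = proj₁ (alt-colors (HamAltCycle.cycle H₁)) ; κy = proj₁ (alt-colors (HamAltCycle.cycle H₂))
    ; colX = proj₁ (proj₂ (alt-colors (HamAltCycle.cycle H₁)))
    ; colY = proj₁ (proj₂ (alt-colors (HamAltCycle.cycle H₂)))
    ; κx-alt = proj₂ (proj₂ (alt-colors (HamAltCycle.cycle H₁)))
    ; κy-alt = proj₂ (proj₂ (alt-colors (HamAltCycle.cycle H₂)))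
    ; covX = λ u → let (i , _ , e) = HamAltCycle.covers H₁ u in i , e
    ; covY = λ w → let (j , _ , e) = HamAltCycle.covers H₂ w in j , e
    }

module _ {V₁ V₂ : Set} {col₁ : Coloring V₁} {col₂ : Coloring V₂} (C : CyclePair col₁ col₂)
  (ext : V₁ → V₂ → Color) (noGood : NoGoodPair col₁ col₂ ext (2 * CyclePair.n C) (CyclePair.x C)
                                                          (2 * CyclePair.m C) (CyclePair.y C)) where

  open CyclePair C

  private
    module X = DoubleMoves col₁ n n≥2 x perX κx colX κx-alt
    module Y = DoubleMoves col₂ m m≥2 y perY κy colY κy-alt

    E : ℕ → ℕ → Color
    E i j = ext (x i) (y j)

    noGood′ : ∀ c i j → E i j ≡ c → ext (nbr c col₁ (2 * n) x i) (nbr c col₂ (2 * m) y j) ≡ flipC c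
    noGood′ c i j e with ≡-or-≡flipC (ext (nbr c col₁ (2 * n) x i) (nbr c col₂ (2 * m) y j)) c
    ... | inj₁ e′ = ⊥-elim (noGood i j c e e′)
    ... | inj₂ e′ = e′

    step-preserves : ∀ c i j sx sy → X.Step c i sx → Y.Step c j sy → E i j ≡ c → E (i + sx) (j + sy) ≡ c
    step-preserves c i j sx sy stX stY e =
      let (i₁ , toI₁ , fromI₁) = X.doubleMove c i sx stX
          (j₁ , toJ₁ , fromJ₁) = Y.doubleMove c j sy stY
          e₁ : E i₁ j₁ ≡ flipC c
          e₁ = trans (sym (cong₂ ext toI₁ toJ₁)) (noGood′ c i j e)
      in trans (trans (sym (cong₂ ext fromI₁ fromJ₁)) (noGood′ (flipC c) i₁ j₁ e₁)) (flipC-involutive c)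

    steps-preserve : ∀ c i j sx sy → X.Step c i sx → Y.Step c j sy → E i j ≡ c →
                     ∀ k → E (i + k * sx) (j + k * sy) ≡ c
    steps-preserve c i j sx sy stX stY e zero = trans (cong₂ E (+-identityʳ i) (+-identityʳ j)) e
    steps-preserve c i j sx sy stX stY e (suc k) =
      trans (sym (cong₂ E (shift i k sx) (shift j k sy)))
        (step-preserves c (i + k * sx) (j + k * sy) sx sy (X.step-+* c i sx k stX) (Y.step-+* c j sy k stY)
                        (steps-preserve c i j sx sy stX stY e k))
      where
      shift : ∀ i k s → i + k * s + s ≡ i + suc k * s
      shift = solve-∀

    nm-pred : Σ ℕ λ N′ → n * m ≡ suc N′
    nm-pred with n | m | n≥2 | m≥2
    ... | suc n′ | suc m′ | _ | _ = m′ + n′ * suc m′ , refl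

    step-reflects : ∀ c i j sx sy → X.Step c i sx → Y.Step c j sy → E (i + sx) (j + sy) ≡ c → E i j ≡ c
    step-reflects c i j sx sy stX stY e = trans (sym (cong₂ ext backX backY)) around
      where
      N′ : ℕ
      N′ = proj₁ nm-pred
      around : E (i + sx + N′ * sx) (j + sy + N′ * sy) ≡ c
      around = steps-preserve c (i + sx) (j + sy) sx sy (X.step-+ c i sx stX) (Y.step-+ c j sy stY) e N′
      shift : ∀ i s N′ → i + s + N′ * s ≡ i + suc N′ * s
      shift = solve-∀
      backX : x (i + sx + N′ * sx) ≡ x i
      backX = trans (cong x (trans (shift i sx N′) (cong (λ k → i + k * sx) (sym (proj₂ nm-pred)))))
                    (X.step-return i sx m (c , stX))
      backY : y (j + sy + N′ * sy) ≡ y j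
      backY = trans (cong y (trans (shift j sy N′) (cong (λ k → j + k * sy) (trans (sym (proj₂ nm-pred)) (*-comm n m)))))
                    (Y.step-return j sy n (c , stY))

    x-suc-+PP : ∀ i → x (suc i + (X.P + X.P)) ≡ x (i + X.P)
    x-suc-+PP i = trans (cong x (cong suc (sym (+-assoc i X.P X.P)))) (X.z-suc-+P (i + X.P))

    y-suc-+PP : ∀ j → y (suc j + (Y.P + Y.P)) ≡ y (j + Y.P)
    y-suc-+PP j = trans (cong y (cong suc (sym (+-assoc j Y.P Y.P)))) (Y.z-suc-+P (j + Y.P))

    just-flipC² : ∀ c → just c ≡ just (flipC (flipC c))
    just-flipC² c = cong just (sym (flipC-involutive c))

    rigid-parallel : ∀ i j → κx i ≡ κy j → E (suc i) (suc j) ≡ flipC (E i j)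
    rigid-parallel i j κ≡ with ≡-or-≡flipC (E i j) (κx i)
    ... | inj₁ e =
      trans (trans (sym (cong₂ ext (nbr-forward col₁ (2 * n) x i (κx i) (colX i))
                                   (nbr-forward col₂ (2 * m) y j (κx i) (trans (colY j) (cong just (sym κ≡))))))
                   (noGood′ (κx i) i j e))
            (cong flipC (sym e))
    ... | inj₂ e =
      trans (step-reflects c (suc i) (suc j) (X.P + X.P) (Y.P + Y.P)
               (inj₂ (κx-alt i , refl)) (inj₂ (trans (κy-alt j) (cong flipC (sym κ≡)) , refl)) backwards)
            (trans (sym (flipC-involutive c)) (cong flipC (sym e)))
      where
      c : Color
      c = κx i
      backwards : E (suc i + (X.P + X.P)) (suc j + (Y.P + Y.P)) ≡ c
      backwards = trans (cong₂ ext (x-suc-+PP i) (y-suc-+PP j))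
        (trans (sym (cong₂ ext (nbr-backward col₁ (2 * n) x i (flipC c) (trans (colX i) (just-flipC² c)))
                               (nbr-backward col₂ (2 * m) y j (flipC c)
                                  (trans (colY j) (trans (cong just (sym κ≡)) (just-flipC² c))))))
               (trans (noGood′ (flipC c) i j e) (flipC-involutive c)))

    rigid-crossed : ∀ i j → κx i ≡ κy j → E (suc i) j ≡ flipC (E i (suc j))
    rigid-crossed i j κ≡ with ≡-or-≡flipC (E i (suc j)) (κx i)
    ... | inj₁ e =
      trans (trans (sym (cong₂ ext (nbr-forward col₁ (2 * n) x i (κx i) (colX i))
                                   (trans (nbr-backward col₂ (2 * m) y (suc j) (κx i)
                                             (trans (colY (suc j)) (cong just (trans (κy-alt j) (cong flipC (sym κ≡))))))
                                          (Y.z-suc-+P j))))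
                   (noGood′ (κx i) i (suc j) e))
            (cong flipC (sym e))
    ... | inj₂ e =
      trans (step-reflects c (suc i) j (X.P + X.P) 2 (inj₂ (κx-alt i , refl)) (inj₁ (sym κ≡ , refl)) backwards)
            (trans (sym (flipC-involutive c)) (cong flipC (sym e)))
      where
      c : Color
      c = κx i
      backwards : E (suc i + (X.P + X.P)) (j + 2) ≡ c
      backwards = trans (cong₂ ext (x-suc-+PP i) (cong y (+-comm j 2)))
        (trans (sym (cong₂ ext (nbr-backward col₁ (2 * n) x i (flipC c) (trans (colX i) (just-flipC² c)))
                               (nbr-forward col₂ (2 * m) y (suc j) (flipC c)
                                  (trans (colY (suc j)) (cong just (trans (κy-alt j) (cong flipC (sym κ≡))))))))
               (trans (noGood′ (flipC c) i (suc j) e) (flipC-involutive c)))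

  noGoodPair⇒rigid : Rigid C ext
  noGoodPair⇒rigid i j κ≡ = rigid-parallel i j κ≡ , rigid-crossed i j κ≡

AltCycleThrough : {V : Set} → Coloring V → ℕ → V → Set
AltCycleThrough {V} col ℓ v = ∃ λ (w : ℕ → V) → AltCycle col ℓ w × PassesThrough w v

*-2*-comm : ∀ k N → k * (2 * N) ≡ 2 * (k * N)
*-2*-comm = solve-∀

module Exterior {V₁ V₂ : Set} {col₁ : Coloring V₁} {col₂ : Coloring V₂}
  (C : CyclePair col₁ col₂) (ext : V₁ → V₂ → Color) where

  open CyclePair C public

  n-nonZero : NonZero n
  n-nonZero = >-nonZero (≤-trans (s≤s z≤n) n≥2)

  m-nonZero : NonZero m
  m-nonZero = >-nonZero (≤-trans (s≤s z≤n) m≥2)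

  instance
    2n-nonZero : NonZero (2 * n)
    2n-nonZero = >-nonZero (≤-trans (s≤s z≤n) (≤-trans n≥2 (m≤m+n n (n + 0))))
    2m-nonZero : NonZero (2 * m)
    2m-nonZero = >-nonZero (≤-trans (s≤s z≤n) (≤-trans m≥2 (m≤m+n m (m + 0))))

  E : ℕ → ℕ → Color
  E i j = ext (x i) (y j)

  rel : ℕ → ℕ → Color
  rel i j = relColor (E i j) (κx i)

  Opposed : ℕ → ℕ → Set
  Opposed i j = κy j ≡ flipC (κx i)

  Aligned : ℕ → ℕ → Set
  Aligned i j = κy j ≡ κx i

  diag : ℕ → Color
  diag s = rel s 0

  NonconstantOn : (ℕ → ℕ → Set) → Set
  NonconstantOn P = ∃ λ i₁ → ∃ λ j₁ → ∃ λ i₂ → ∃ λ j₂ → P i₁ j₁ × P i₂ j₂ × rel i₁ j₁ ≢ rel i₂ j₂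

  OpposedNonconstant AlignedNonconstant : Set
  OpposedNonconstant = NonconstantOn Opposed
  AlignedNonconstant = NonconstantOn Aligned

module Diagonal {V₁ V₂ : Set} {col₁ : Coloring V₁} {col₂ : Coloring V₂}
  (C : CyclePair col₁ col₂) (ext : V₁ → V₂ → Color) (rigid : Rigid C ext) where

  open Exterior C ext public

  κx-periodic : ∀ i k → κx (i + k * (2 * n)) ≡ κx i
  κx-periodic i k = trans (cong (λ t → κx (i + t)) (*-2*-comm k n)) (alternating-even κx-alt i (k * n))

  κy-periodic : ∀ j k → κy (j + k * (2 * m)) ≡ κy j
  κy-periodic j k = trans (cong (λ t → κy (j + t)) (*-2*-comm k m)) (alternating-even κy-alt j (k * m))

  private
    opposed-suc : ∀ i j → Opposed i (suc j) → κx i ≡ κy j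
    opposed-suc i j o = flipC-injective (trans (sym o) (κy-alt j))

    opposed-pred : ∀ i j → κx i ≡ κy j → Opposed (suc i) j
    opposed-pred i j κ≡ = trans (sym κ≡) (sym (trans (cong flipC (κx-alt i)) (flipC-involutive _)))

  opposed-shift : ∀ j i → Opposed (i + j) 0 → Opposed i j
  opposed-shift zero    i o = trans o (cong (λ k → flipC (κx k)) (+-identityʳ i))
  opposed-shift (suc j) i o =
    trans (κy-alt j) (cong flipC (trans (opposed-shift j (suc i) (subst (λ k → Opposed k 0) (+-suc i j) o))
                                        (trans (cong flipC (κx-alt i)) (flipC-involutive _))))

  opposed-unshift : ∀ j i → Opposed i j → Opposed (i + j) 0
  opposed-unshift zero    i o = trans o (cong (λ k → flipC (κx k)) (sym (+-identityʳ i)))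
  opposed-unshift (suc j) i o =
    subst (λ k → Opposed k 0) (sym (+-suc i j)) (opposed-unshift j (suc i) (opposed-pred i j (opposed-suc i j o)))

  rel-diag : ∀ j i → Opposed i j → rel i j ≡ diag (i + j)
  rel-diag zero    i o = cong diag (sym (+-identityʳ i))
  rel-diag (suc j) i o = begin
    rel i (suc j)                                 ≡⟨ sym (relColor-flipC-flipC (E i (suc j)) (κx i)) ⟩
    relColor (flipC (E i (suc j))) (flipC (κx i)) ≡⟨ cong₂ relColor (sym (proj₂ (rigid i j κ≡))) (sym (κx-alt i)) ⟩
    rel (suc i) j                                 ≡⟨ rel-diag j (suc i) (opposed-pred i j κ≡) ⟩
    diag (suc i + j)                              ≡⟨ cong diag (sym (+-suc i j)) ⟩
    diag (i + suc j)                              ∎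
    where
    open ≡-Reasoning
    κ≡ : κx i ≡ κy j
    κ≡ = opposed-suc i j o

  opposed-+even : ∀ s k → Opposed s 0 → Opposed (s + 2 * k) 0
  opposed-+even s k o = trans o (cong flipC (sym (alternating-even κx-alt s k)))

  opposed-+periods : ∀ s K₁ K₂ → Opposed s 0 → Opposed (s + K₁ * (2 * n) + K₂ * (2 * m)) 0
  opposed-+periods s K₁ K₂ o =
    subst (λ t → Opposed t 0) (sym (cong₂ (λ a b → s + a + b) (*-2*-comm K₁ n) (*-2*-comm K₂ m)))
      (opposed-+even (s + 2 * (K₁ * n)) (K₂ * m) (opposed-+even s (K₁ * n) o))

  diag-+periodX : ∀ s k → diag (s + k * (2 * n)) ≡ diag s
  diag-+periodX s k = cong₂ relColor (cong (λ u → ext u (y 0)) (Periodic.periodic-* (2 * n) x perX s k)) (κx-periodic s k)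

  diag-+periodY : ∀ s k → Opposed s 0 → diag (s + k * (2 * m)) ≡ diag s
  diag-+periodY s k o = begin
    diag (s + k * (2 * m))   ≡⟨ sym (rel-diag (k * (2 * m)) s (trans (κy-periodic 0 k) o)) ⟩
    rel s (0 + k * (2 * m))  ≡⟨ cong (λ w → relColor (ext (x s) w) (κx s)) (Periodic.periodic-* (2 * m) y perY 0 k) ⟩
    diag s                   ∎
    where open ≡-Reasoning

  DiagIs : Color → ℕ → Set
  DiagIs c s = Opposed s 0 × diag s ≡ c

  diagIs-+periods : ∀ {c} s K₁ K₂ → DiagIs c s → DiagIs c (s + K₁ * (2 * n) + K₂ * (2 * m))
  diagIs-+periods s K₁ K₂ (o , d) =
    opposed-+periods s K₁ K₂ o ,
    trans (diag-+periodY (s + K₁ * (2 * n)) K₂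
             (subst (λ t → Opposed (s + t) 0) (sym (*-2*-comm K₁ n)) (opposed-+even s (K₁ * n) o)))
          (trans (diag-+periodX s K₁) d)

  diagIs-≡ : ∀ {c s t} → DiagIs c s → s ≡ t → DiagIs c t
  diagIs-≡ d refl = d

  diagIs-shift : ∀ {c b s} K₁ K₂ → DiagIs c b → s ≡ b + K₁ * (2 * n) + K₂ * (2 * m) → DiagIs c s
  diagIs-shift K₁ K₂ d e = diagIs-≡ (diagIs-+periods _ K₁ K₂ d) (sym e)

  diag-≡-+periods : ∀ {s b} K₁ K₂ L₁ L₂ → Opposed s 0 → Opposed b 0 →
                    s + K₁ * (2 * n) + K₂ * (2 * m) ≡ b + L₁ * (2 * n) + L₂ * (2 * m) → diag s ≡ diag b
  diag-≡-+periods {s} {b} K₁ K₂ L₁ L₂ os ob e =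
    trans (sym (proj₂ (diagIs-+periods s K₁ K₂ (os , refl))))
          (trans (cong diag e) (proj₂ (diagIs-+periods b L₁ L₂ (ob , refl))))

  diag-colorChange : ∀ {c} s k → DiagIs c s → diag (s + 2 * k) ≡ flipC c →
                     ∃ λ t → t < k × DiagIs c (s + 2 * t) × DiagIs (flipC c) (s + 2 * t + 2)
  diag-colorChange {c} s k (o , d) dk =
    let (t , t<k , dt , dst) = colorChange (λ t → diag (s + 2 * t)) c k (trans (cong diag (+-identityʳ s)) d) dk
    in t , t<k , (opposed-+even s t o , dt) ,
       (subst (λ r → Opposed r 0) (r s t) (opposed-+even s (suc t) o) , trans (cong diag (sym (r s t))) dst)
    where
    r : ∀ s t → s + 2 * suc t ≡ s + 2 * t + 2
    r = solve-∀

  private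
    2+2*pred : ∀ k .{{_ : NonZero k}} → 2 + 2 * pred k ≡ 2 * k
    2+2*pred (suc k) = sym (*-suc 2 k)

  diag-aroundX : ∀ {c} s → DiagIs c s → diag (s + 2 + 2 * pred n) ≡ c
  diag-aroundX s d =
    trans (cong diag (trans (+-assoc s 2 _) (trans (cong (s +_) (2+2*pred n {{n-nonZero}})) (r s (2 * n) (2 * m)))))
          (proj₂ (diagIs-+periods s 1 0 d))
    where
    r : ∀ s N M → s + N ≡ s + 1 * N + 0 * M
    r = solve-∀

  diag-aroundY : ∀ {c} s → DiagIs c s → diag (s + 2 + 2 * pred m) ≡ c
  diag-aroundY s d =
    trans (cong diag (trans (+-assoc s 2 _) (trans (cong (s +_) (2+2*pred m {{m-nonZero}})) (r s (2 * n) (2 * m)))))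
          (proj₂ (diagIs-+periods s 0 1 d))
    where
    r : ∀ s N M → s + M ≡ s + 0 * N + 1 * M
    r = solve-∀

  redToBlue : ∀ {c} s → DiagIs c s → DiagIs (flipC c) (s + 2) → ∃ λ s′ → DiagIs red s′ × DiagIs blue (s′ + 2)
  redToBlue {red}  s d d′ = s , d , d′
  redToBlue {blue} s d d′ =
    let (t , _ , red-t , blue-t) = diag-colorChange (s + 2) (pred n) d′ (diag-aroundX s d) in s + 2 + 2 * t , red-t , blue-t

  record Switch : Set where
    field
      s u m₀ : ℕ
      m≡     : m ≡ u + 2 + m₀
      red₀   : DiagIs red s
      blue₀  : DiagIs blue (s + 2)
      blue₁  : DiagIs blue (s + 2 * u + 2)
      red₁   : DiagIs red (s + 2 * u + 4)

  switch-from : ∀ s → DiagIs red s → DiagIs blue (s + 2) → Switch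
  switch-from s red₀ blue₀ = record
    { s = s ; u = t ; m₀ = m₀ ; m≡ = m≡ ; red₀ = red₀ ; blue₀ = blue₀
    ; blue₁ = diagIs-≡ (proj₁ (proj₂ (proj₂ change))) (r₁ s t)
    ; red₁  = diagIs-≡ (proj₂ (proj₂ (proj₂ change))) (r₂ s t) }
    where
    change : ∃ λ t → t < pred m × DiagIs blue (s + 2 + 2 * t) × DiagIs red (s + 2 + 2 * t + 2)
    change = diag-colorChange (s + 2) (pred m) blue₀ (diag-aroundY s red₀)
    t : ℕ
    t = proj₁ change
    gap : ∃ λ m₀ → suc t + m₀ ≡ pred m
    gap = m≤n⇒∃[o]m+o≡n (proj₁ (proj₂ change))
    m₀ : ℕ
    m₀ = proj₁ gap
    r : ∀ t m₀ → suc (suc t + m₀) ≡ t + 2 + m₀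
    r = solve-∀
    m≡ : m ≡ t + 2 + m₀
    m≡ = trans (sym (suc-pred m {{m-nonZero}})) (trans (cong suc (sym (proj₂ gap))) (r t m₀))
    r₁ : ∀ s t → s + 2 + 2 * t ≡ s + 2 * t + 2
    r₁ = solve-∀
    r₂ : ∀ s t → s + 2 + 2 * t + 2 ≡ s + 2 * t + 4
    r₂ = solve-∀

  nonconstant⇒switch : OpposedNonconstant → Switch
  nonconstant⇒switch (i₁ , j₁ , i₂ , j₂ , o₁ , o₂ , rel≢) =
    let (t , _ , d-t , d-t+2) = diag-colorChange σ₁ k (oσ₁ , refl) far
        (s , red₀ , blue₀) = redToBlue (σ₁ + 2 * t) d-t d-t+2
    in switch-from s red₀ blue₀
    where
    σ₁ σ₂ : ℕ
    σ₁ = i₁ + j₁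
    σ₂ = i₂ + j₂ + σ₁ * (2 * n) + 0 * (2 * m)
    oσ₁ : Opposed σ₁ 0
    oσ₁ = opposed-unshift j₁ i₁ o₁
    dσ₂ : DiagIs (diag (i₂ + j₂)) σ₂
    dσ₂ = diagIs-+periods (i₂ + j₂) σ₁ 0 (opposed-unshift j₂ i₂ o₂ , refl)
    diag≢ : diag σ₁ ≢ diag σ₂
    diag≢ e = rel≢ (trans (rel-diag j₁ i₁ o₁) (trans e (trans (proj₂ dσ₂) (sym (rel-diag j₂ i₂ o₂)))))
    σ₁≤σ₂ : σ₁ ≤ σ₂
    σ₁≤σ₂ = ≤-trans (≤-trans (m≤m*n σ₁ (2 * n)) (m≤n+m _ (i₂ + j₂))) (m≤m+n _ (0 * (2 * m)))
    d : ℕ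
    d = proj₁ (m≤n⇒∃[o]m+o≡n σ₁≤σ₂)
    σ₁+d≡σ₂ : σ₁ + d ≡ σ₂
    σ₁+d≡σ₂ = proj₂ (m≤n⇒∃[o]m+o≡n σ₁≤σ₂)
    d-even : ∃ λ k → d ≡ 2 * k
    d-even = flips-fixed⇒even d (κx σ₁)
               (trans (sym (alternating-+ κx-alt σ₁ d))
                      (trans (cong κx σ₁+d≡σ₂) (flipC-injective (trans (sym (proj₁ dσ₂)) oσ₁))))
    k : ℕ
    k = proj₁ d-even
    far : diag (σ₁ + 2 * k) ≡ flipC (diag σ₁)
    far = ≢⇒≡flipC (λ e → diag≢ (sym (trans (cong diag (trans (sym σ₁+d≡σ₂) (cong (σ₁ +_) (proj₂ d-even)))) e)))

module Nonsingular {V₁ V₂ : Set} {col₁ : Coloring V₁} {col₂ : Coloring V₂}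
  (C : CyclePair col₁ col₂) (ext : V₁ → V₂ → Color) where

  open Exterior C ext

  exterior-flipC-at-x : ∀ a c → ¬ (∀ u → ext (x a) u ≡ c) → ∃ λ j → E a j ≡ flipC c
  exterior-flipC-at-x a c not-c with constant-or-flipC (E a) c (2 * m)
  ... | inj₂ w        = w
  ... | inj₁ constant = ⊥-elim (not-c λ u → let (j , yj≡u) = covY u in
          trans (cong (ext (x a)) (trans (sym yj≡u) (Periodic.periodic-% (2 * m) y perY j)))
                (constant (j % (2 * m)) (m%n<n j (2 * m))))

  exterior-flipC-at-y : ∀ b c → ¬ (∀ u → ext u (y b) ≡ c) → ∃ λ i → E i b ≡ flipC c
  exterior-flipC-at-y b c not-c with constant-or-flipC (λ i → E i b) c (2 * n)
  ... | inj₂ w        = w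
  ... | inj₁ constant = ⊥-elim (not-c λ u → let (i , xi≡u) = covX u in
          trans (cong (λ v → ext v (y b)) (trans (sym xi≡u) (Periodic.periodic-% (2 * n) x perX i)))
                (constant (i % (2 * n)) (m%n<n i (2 * n))))

  relY : ℕ → ℕ → Color
  relY i j = relColor (E i j) (κy j)

  rel-opposed : ∀ i j → Opposed i j → rel i j ≡ flipC (relY i j)
  rel-opposed i j o = begin
    relColor (E i j) (κx i)          ≡⟨ cong (relColor (E i j)) (flipC-injective (trans (sym o) (sym (flipC-involutive _)))) ⟩
    relColor (E i j) (flipC (κy j))  ≡⟨ relColor-flipCʳ (E i j) (κy j) ⟩
    flipC (relY i j)                 ∎
    where open ≡-Reasoning

  rel-aligned : ∀ i j → Aligned i j → rel i j ≡ relY i j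
  rel-aligned i j al = cong (relColor (E i j)) (sym al)

  Kind : ℕ → ℕ → Set
  Kind i j = Opposed i j ⊎ Aligned i j

  kind : ∀ i j → Kind i j
  kind i j with ≡-or-≡flipC (κy j) (κx i)
  ... | inj₁ al = inj₂ al
  ... | inj₂ o  = inj₁ o

  mixed-rel≡ : ∀ i i′ b → Opposed i b → Aligned i′ b → relY i b ≢ relY i′ b → rel i b ≡ rel i′ b
  mixed-rel≡ i i′ b o al relY≢ =
    trans (rel-opposed i b o) (trans (sym (≢⇒≡flipC (λ e → relY≢ (sym e)))) (sym (rel-aligned i′ b al)))

  mixed⇒nonconstant : ∀ a pₒ pₐ qₒ qₐ b → Opposed a pₒ → Aligned a pₐ → rel a pₒ ≢ rel a pₐ →
                      Opposed qₒ b → Aligned qₐ b → relY qₒ b ≢ relY qₐ b →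
                      OpposedNonconstant ⊎ AlignedNonconstant
  mixed⇒nonconstant a pₒ pₐ qₒ qₐ b o₁ al₁ rel≢ o₂ al₂ relY≢ with ≡-or-≡flipC (rel a pₒ) (rel qₒ b)
  ... | inj₂ e = inj₁ (a , pₒ , qₒ , b , o₁ , o₂ , λ e′ → flipC-≢ _ (trans (sym e) e′))
  ... | inj₁ e = inj₂ (a , pₐ , qₐ , b , al₁ , al₂ ,
                       λ e′ → rel≢ (trans e (trans (mixed-rel≡ qₒ qₐ b o₂ al₂ relY≢) (sym e′))))

  nonsingular⇒nonconstant : (∃ λ v → NonSingular ext v) → (∃ λ w → NonSingular (λ a b → ext b a) w) →
                            OpposedNonconstant ⊎ AlignedNonconstant
  nonsingular⇒nonconstant (v , not-red , not-blue) (w , not-red′ , not-blue′) =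
    combine (kind a j₁) (kind a j₂) (kind i₁ b) (kind i₂ b)
    where
    a b : ℕ
    a = proj₁ (covX v)
    b = proj₁ (covY w)
    at-v : ∀ c → ¬ (∀ u → ext v u ≡ c) → ¬ (∀ u → ext (x a) u ≡ c)
    at-v c not-c all-c = not-c (λ u → subst (λ v′ → ext v′ u ≡ c) (proj₂ (covX v)) (all-c u))
    at-w : ∀ c → ¬ (∀ u → ext u w ≡ c) → ¬ (∀ u → ext u (y b) ≡ c)
    at-w c not-c all-c = not-c (λ u → subst (λ w′ → ext u w′ ≡ c) (proj₂ (covY w)) (all-c u))
    j₁ j₂ i₁ i₂ : ℕ
    j₁ = proj₁ (exterior-flipC-at-x a red (at-v red not-red))
    j₂ = proj₁ (exterior-flipC-at-x a blue (at-v blue not-blue))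
    i₁ = proj₁ (exterior-flipC-at-y b red (at-w red not-red′))
    i₂ = proj₁ (exterior-flipC-at-y b blue (at-w blue not-blue′))
    E≢ : ∀ {c₁ c₂ c₃ : Color} → c₁ ≡ blue → c₂ ≡ red → relColor c₁ c₃ ≢ relColor c₂ c₃
    E≢ {c₃ = c₃} refl refl e = flipC-≢ red (relColor-injectiveˡ blue red c₃ e)
    relX≢ : rel a j₁ ≢ rel a j₂
    relX≢ = E≢ (proj₂ (exterior-flipC-at-x a red (at-v red not-red)))
               (proj₂ (exterior-flipC-at-x a blue (at-v blue not-blue)))
    relY≢ : relY i₁ b ≢ relY i₂ b
    relY≢ = E≢ (proj₂ (exterior-flipC-at-y b red (at-w red not-red′)))
               (proj₂ (exterior-flipC-at-y b blue (at-w blue not-blue′)))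
    combine : Kind a j₁ → Kind a j₂ → Kind i₁ b → Kind i₂ b → OpposedNonconstant ⊎ AlignedNonconstant
    combine (inj₁ o₁)  (inj₁ o₂)  _ _ = inj₁ (a , j₁ , a , j₂ , o₁ , o₂ , relX≢)
    combine (inj₂ al₁) (inj₂ al₂) _ _ = inj₂ (a , j₁ , a , j₂ , al₁ , al₂ , relX≢)
    combine _ _ (inj₁ o₁)  (inj₁ o₂)  =
      inj₁ (i₁ , b , i₂ , b , o₁ , o₂ ,
            λ e → relY≢ (flipC-injective (trans (sym (rel-opposed i₁ b o₁)) (trans e (rel-opposed i₂ b o₂)))))
    combine _ _ (inj₂ al₁) (inj₂ al₂) =
      inj₂ (i₁ , b , i₂ , b , al₁ , al₂ ,
            λ e → relY≢ (trans (sym (rel-aligned i₁ b al₁)) (trans e (rel-aligned i₂ b al₂))))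
    combine (inj₁ o₁) (inj₂ al₂) (inj₁ o₃) (inj₂ al₄) =
      mixed⇒nonconstant a j₁ j₂ i₁ i₂ b o₁ al₂ relX≢ o₃ al₄ relY≢
    combine (inj₁ o₁) (inj₂ al₂) (inj₂ al₃) (inj₁ o₄) =
      mixed⇒nonconstant a j₁ j₂ i₂ i₁ b o₁ al₂ relX≢ o₄ al₃ (λ e → relY≢ (sym e))
    combine (inj₂ al₁) (inj₁ o₂) (inj₁ o₃) (inj₂ al₄) =
      mixed⇒nonconstant a j₂ j₁ i₁ i₂ b o₂ al₁ (λ e → relX≢ (sym e)) o₃ al₄ relY≢
    combine (inj₂ al₁) (inj₁ o₂) (inj₂ al₃) (inj₁ o₄) =
      mixed⇒nonconstant a j₂ j₁ i₂ i₁ b o₂ al₁ (λ e → relX≢ (sym e)) o₄ al₃ (λ e → relY≢ (sym e))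

-- Traversing the second cycle backwards: j ↦ y (M * j) with M = 2m - 1 ≡ -1 (mod 2m).
module Reversal {V₁ V₂ : Set} {col₁ : Coloring V₁} {col₂ : Coloring V₂}
  (C : CyclePair col₁ col₂) (ext : V₁ → V₂ → Color) (symm₂ : ∀ u v → col₂ u v ≡ col₂ v u) where

  open Exterior C ext

  M₀ : ℕ
  M₀ = pred (pred (2 * m))

  private
    2m≡ : 2 * m ≡ suc (suc M₀)
    2m≡ with m | m≥2
    ... | suc (suc _) | _           = refl
    ... | suc zero    | s≤s ()

  M : ℕ
  M = suc M₀

  y-+periods : ∀ j k → y (j + k * suc M) ≡ y j
  y-+periods j k = trans (cong (λ t → y (j + k * t)) (sym 2m≡)) (Periodic.periodic-* (2 * m) y perY j k)

  κy-+periods : ∀ j k → κy (j + k * suc M) ≡ κy j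
  κy-+periods j k = trans (cong (λ t → κy (j + k * t)) (sym 2m≡))
                          (trans (cong (λ t → κy (j + t)) (*-2*-comm k m)) (alternating-even κy-alt j (k * m)))

  yR : ℕ → V₂
  yR j = y (M * j)

  κR : ℕ → Color
  κR j = κy (M * suc j)

  yR-involutive : ∀ j → y (M * (M * j)) ≡ y j
  yR-involutive j = trans (cong y (r M₀ j)) (y-+periods j (M₀ * j))
    where
    r : ∀ M₀ j → suc M₀ * (suc M₀ * j) ≡ j + (M₀ * j) * suc (suc M₀)
    r = solve-∀

  y-suc-M* : ∀ j → y (suc (M * suc j)) ≡ yR j
  y-suc-M* j = trans (cong y (r M₀ j)) (y-+periods (M * j) 1)
    where
    r : ∀ M₀ j → suc (suc M₀ * suc j) ≡ suc M₀ * j + 1 * suc (suc M₀)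
    r = solve-∀

  yR-% : ∀ a → yR a ≡ yR (a % (2 * m))
  yR-% a = trans (cong (λ t → y (M * t)) (m≡m%n+[m/n]*n a (2 * m)))
             (trans (cong (λ t → y (M * (a % (2 * m) + (a / (2 * m)) * t))) 2m≡)
               (trans (cong y (r M₀ (a % (2 * m)) (a / (2 * m)))) (y-+periods _ (M * (a / (2 * m))))))
    where
    r : ∀ M₀ a q → suc M₀ * (a + q * suc (suc M₀)) ≡ suc M₀ * a + (suc M₀ * q) * suc (suc M₀)
    r = solve-∀

  κy-M+ : ∀ j → κy (M + j) ≡ flipC (κy j)
  κy-M+ j = flipC-injective (trans (sym (κy-alt (M + j)))
              (trans (cong κy (trans (+-comm (suc M) j) (cong (j +_) (sym (*-identityˡ (suc M))))))
                     (trans (κy-+periods j 1) (sym (flipC-involutive _)))))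

  reverseY : CyclePair col₁ col₂
  reverseY = record
    { n = n ; m = m ; n≥2 = n≥2 ; m≥2 = m≥2 ; x = x ; y = yR
    ; perX = perX
    ; perY = λ j → trans (cong (λ t → y (M * (j + t))) 2m≡) (trans (cong y (r M₀ j)) (y-+periods (M * j) M))
    ; distX = distX
    ; distY = λ i j i< j< e → trans (sym (m<n⇒m%n≡m i<)) (trans
        (Periodic.Distinct.≡⇒%-≡ (2 * m) y perY distY i j
          (trans (sym (yR-involutive i)) (trans (yR-% (M * i))
            (trans (cong yR (Periodic.Distinct.≡⇒%-≡ (2 * m) y perY distY (M * i) (M * j) e))
              (trans (sym (yR-% (M * j))) (yR-involutive j))))))
        (m<n⇒m%n≡m j<))
    ; κx = κx ; κy = κR
    ; colX = colX
    ; colY = λ j → trans (cong (λ v → col₂ v (yR (suc j))) (sym (y-suc-M* j))) (trans (symm₂ _ _) (colY (M * suc j)))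
    ; κx-alt = κx-alt
    ; κy-alt = λ j → trans (sym (flipC-involutive _)) (cong flipC (trans (sym (κy-alt (M * suc (suc j))))
                       (trans (cong κy (r′ M₀ (suc j))) (κy-+periods (M * suc j) 1))))
    ; covX = covX
    ; covY = λ w → let (j , yj≡w) = covY w in M * j , trans (yR-involutive j) yj≡w
    }
    where
    r : ∀ M₀ j → suc M₀ * (j + suc (suc M₀)) ≡ suc M₀ * j + suc M₀ * suc (suc M₀)
    r = solve-∀
    r′ : ∀ M₀ j → suc (suc M₀ * suc j) ≡ suc M₀ * j + 1 * suc (suc M₀)
    r′ = solve-∀

  reverseY-rigid : Rigid C ext → Rigid reverseY ext
  reverseY-rigid rigid i j κ≡ =
    let (parallel , crossed) = rigid i (M * suc j) κ≡
    in trans crossed (cong (λ w → flipC (ext (x i) w)) (y-suc-M* j)) ,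
       trans (cong (ext (x (suc i))) (sym (y-suc-M* j))) parallel

  aligned⇒opposed : AlignedNonconstant → Exterior.OpposedNonconstant reverseY ext
  aligned⇒opposed (i₁ , j₁ , i₂ , j₂ , al₁ , al₂ , rel≢) =
    i₁ , M * j₁ , i₂ , M * j₂ , opposed-reversed i₁ j₁ al₁ , opposed-reversed i₂ j₂ al₂ ,
    λ e → rel≢ (trans (cong (λ w → relColor (ext (x i₁) w) (κx i₁)) (sym (yR-involutive j₁)))
                 (trans e (cong (λ w → relColor (ext (x i₂) w) (κx i₂)) (yR-involutive j₂))))
    where
    opposed-reversed : ∀ i j → Aligned i j → κR (M * j) ≡ flipC (κx i)
    opposed-reversed i j al = trans (cong κy (r M₀ j)) (trans (κy-+periods (M + j) (M₀ * j)) (trans (κy-M+ j) (cong flipC al)))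
      where
      r : ∀ M₀ j → suc M₀ * suc (suc M₀ * j) ≡ suc M₀ + j + (M₀ * j) * suc (suc M₀)
      r = solve-∀

module ArcCycles {V₁ V₂ : Set} {col₁ : Coloring V₁} {col₂ : Coloring V₂}
  (C : CyclePair col₁ col₂) (ext : V₁ → V₂ → Color) (rigid : Rigid C ext) where

  open Diagonal C ext rigid
  open Paths (sumCol col₁ col₂ ext)

  xArc : ℕ → ℕ → V₁ ⊎ V₂
  xArc a t = inj₁ (x (a + t))

  yArc : ℕ → ℕ → V₁ ⊎ V₂
  yArc c t = inj₂ (y (c + t))

  xArc-path : ∀ a p → AltPath p (xArc a) (κx a)
  xArc-path a p t _ = trans (cong (col₁ (x (a + t))) (cong x (+-suc a t)))
                            (trans (colX (a + t)) (cong just (alternating-+ κx-alt a t)))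

  yArc-path : ∀ c q → AltPath q (yArc c) (κy c)
  yArc-path c q t _ = trans (cong (col₂ (y (c + t))) (cong y (+-suc c t)))
                            (trans (colY (c + t)) (cong just (alternating-+ κy-alt c t)))

  xArc-injective : ∀ a p → p < 2 * n → InjectiveUpTo p (xArc a)
  xArc-injective a p p< i j i≤ j≤ e =
    Periodic.Distinct.+-injective (2 * n) x perX distX a i j (≤-<-trans i≤ p<) (≤-<-trans j≤ p<) (inj₁-injective e)

  yArc-injective : ∀ c q → q < 2 * m → InjectiveUpTo q (yArc c)
  yArc-injective c q q< i j i≤ j≤ e =
    Periodic.Distinct.+-injective (2 * m) y perY distY c i j (≤-<-trans i≤ q<) (≤-<-trans j≤ q<) (inj₂-injective e)

  xArc≢yArc : ∀ a c p q i j → i ≤ p → j ≤ q → xArc a i ≢ yArc c j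
  xArc≢yArc a c p q i j _ _ ()

  xyJoint : ∀ a p c → DiagIs red (a + p + c) →
            sumCol col₁ col₂ ext (xArc a p) (yArc c 0) ≡ just (flips p (κx a))
            × κy c ≡ flips (suc p) (κx a)
  xyJoint a p c (o , d) =
    cong just (trans (cong (ext (x (a + p))) (cong y (+-identityʳ c)))
                     (trans (relColor-red⇒≡ _ _ (trans (rel-diag c (a + p) o′) d)) (alternating-+ κx-alt a p))) ,
    trans o′ (cong flipC (alternating-+ κx-alt a p))
    where
    o′ : Opposed (a + p) c
    o′ = opposed-shift c (a + p) o

  yxJoint : ∀ a c q → DiagIs blue (a + (c + q)) →
            sumCol col₁ col₂ ext (yArc c q) (xArc a 0) ≡ just (flips q (κy c))
            × κx a ≡ flips (suc q) (κy c)
  yxJoint a c q (o , d) =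
    cong just (trans (cong (λ i → ext (x i) (y (c + q))) (+-identityʳ a))
                     (trans (relColor-blue⇒≡flipC _ _ (trans (rel-diag (c + q) a o′) d))
                            (trans (sym o′) (alternating-+ κy-alt c q)))) ,
    trans (sym (flipC-involutive (κx a))) (cong flipC (trans (sym o′) (alternating-+ κy-alt c q)))
    where
    o′ : Opposed a (c + q)
    o′ = opposed-shift (c + q) a o

  xArc-then : ∀ a p c r R → AltPath r R (κy c) → R 0 ≡ yArc c 0 → DiagIs red (a + p + c) →
              AltPath (suc p + r) (append p (xArc a) R) (κx a)
  xArc-then a p c r R path R0 d =
    altPath-append p r (xArc a) R (κx a) (xArc-path a p) (subst (AltPath r R) (proj₂ (xyJoint a p c d)) path)
      (trans (cong (sumCol col₁ col₂ ext (xArc a p)) R0) (proj₁ (xyJoint a p c d)))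

  yArc-then : ∀ c q a r R → AltPath r R (κx a) → R 0 ≡ xArc a 0 → DiagIs blue (a + (c + q)) →
              AltPath (suc q + r) (append q (yArc c) R) (κy c)
  yArc-then c q a r R path R0 d =
    altPath-append q r (yArc c) R (κy c) (yArc-path c q) (subst (AltPath r R) (proj₂ (yxJoint a c q d)) path)
      (trans (cong (sumCol col₁ col₂ ext (yArc c q)) R0) (proj₁ (yxJoint a c q d)))

  closeAtX : ∀ L W a c q → AltPath L W (κx a) → InjectiveUpTo L W → 2 ≤ L →
             W 0 ≡ xArc a 0 → W L ≡ yArc c q → DiagIs blue (a + (c + q)) →
             flips L (κx a) ≡ flipC (κx a) →
             AltCycle (sumCol col₁ col₂ ext) (suc L) (λ k → W (k % suc L))
  closeAtX L W a c q path inj 2≤L W0 WL d odd =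
    altCycle-close L W (κx a) path closing (trans (cong flipC odd) (flipC-involutive _)) inj 2≤L
    where
    closing : sumCol col₁ col₂ ext (W L) (W 0) ≡ just (flips L (κx a))
    closing = trans (cong₂ (sumCol col₁ col₂ ext) WL W0)
                (trans (proj₁ (yxJoint a c q d))
                  (cong just (trans (flips-pred q (κx a) (κy c) (proj₂ (yxJoint a c q d))) (sym odd))))

  private
    through-ends : ∀ p R L a c → suc p < suc L → R 0 ≡ yArc c 0 →
                   append p (xArc a) R (0 % suc L) ≡ inj₁ (x a) × append p (xArc a) R (suc p % suc L) ≡ inj₂ (y c)
    through-ends p R L a c p< R0 =
      trans (append-≤ p (xArc a) R 0 z≤n) (cong inj₁ (cong x (+-identityʳ a))) ,
      trans (cong (append p (xArc a) R) (m<n⇒m%n≡m p<))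
            (trans (append-suc p (xArc a) R) (trans R0 (cong inj₂ (cong y (+-identityʳ c)))))

  CycleVia : ℕ → ℕ → ℕ → ℕ → Set
  CycleVia ℓ a p c = Σ (ℕ → V₁ ⊎ V₂) λ w → AltCycle (sumCol col₁ col₂ ext) ℓ w
                                           × w 0 ≡ inj₁ (x a) × w (suc p) ≡ inj₂ (y c)

  twoArcCycle : ∀ a p c q → p < 2 * n → q < 2 * m → 1 ≤ p + q →
                DiagIs red (a + p + c) → DiagIs blue (a + (c + q)) → CycleVia (suc (suc p + q)) a p c
  twoArcCycle a p c q p< q< 1≤ red₁ blue₁ =
    (λ k → W (k % suc L)) , cycle , through-ends p (yArc c) L a c (s≤s (s≤s (m≤m+n p q))) refl
    where
    L : ℕ
    L = suc p + q
    W : ℕ → V₁ ⊎ V₂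
    W = append p (xArc a) (yArc c)
    odd : flips L (κx a) ≡ flipC (κx a)
    odd = trans (flips-+-≡ (suc p) q (κx a) (κy c) (proj₂ (xyJoint a p c red₁)))
                (flips-pred q (κx a) (κy c) (proj₂ (yxJoint a c q blue₁)))
    cycle : AltCycle (sumCol col₁ col₂ ext) (suc L) (λ k → W (k % suc L))
    cycle = closeAtX L W a c q (xArc-then a p c q (yArc c) (yArc-path c q) refl red₁)
              (injectiveUpTo-append p q (xArc a) (yArc c) (xArc-injective a p p<) (yArc-injective c q q<) (xArc≢yArc a c p q))
              (s≤s 1≤) (append-≤ p (xArc a) (yArc c) 0 z≤n) (append-suc+ p (xArc a) (yArc c) q) blue₁ odd

  xArc-disjoint : ∀ a p p′ → suc p + p′ < 2 * n → ∀ i → i ≤ p → ∀ j → j ≤ p′ → xArc a i ≢ xArc (a + suc p) j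
  xArc-disjoint a p p′ lt i i≤ j j≤ e = <-irrefl refl (≤-<-trans (≤-reflexive (sym i≡)) (s≤s (≤-trans i≤ (m≤m+n p j))))
    where
    i≡ : i ≡ suc p + j
    i≡ = xArc-injective a (suc p + p′) lt i (suc p + j) (≤-trans i≤ (≤-trans (n≤1+n p) (m≤m+n (suc p) p′)))
           (+-monoʳ-≤ (suc p) j≤) (trans e (cong inj₁ (cong x (+-assoc a (suc p) j))))

  yArc-disjoint : ∀ c q q′ → suc q + q′ < 2 * m → ∀ i → i ≤ q → ∀ j → j ≤ q′ → yArc c i ≢ yArc (c + suc q) j
  yArc-disjoint c q q′ lt i i≤ j j≤ e = <-irrefl refl (≤-<-trans (≤-reflexive (sym i≡)) (s≤s (≤-trans i≤ (m≤m+n q j))))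
    where
    i≡ : i ≡ suc q + j
    i≡ = yArc-injective c (suc q + q′) lt i (suc q + j) (≤-trans i≤ (≤-trans (n≤1+n q) (m≤m+n (suc q) q′)))
           (+-monoʳ-≤ (suc q) j≤) (trans e (cong inj₂ (cong y (+-assoc c (suc q) j))))

  fourArcs : ℕ → ℕ → ℕ → ℕ → ℕ → ℕ → ℕ → V₁ ⊎ V₂
  fourArcs a p₁ p₂ c q₁ q₂ = append p₁ (xArc a) (append q₁ (yArc c) (append p₂ (xArc (a + suc p₁)) (yArc (c + suc q₁))))

  fourArcs-injective : ∀ a p₁ p₂ c q₁ q₂ → suc p₁ + p₂ < 2 * n → suc q₁ + q₂ < 2 * m →
                       InjectiveUpTo (suc p₁ + (suc q₁ + (suc p₂ + q₂))) (fourArcs a p₁ p₂ c q₁ q₂)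
  fourArcs-injective a p₁ p₂ c q₁ q₂ p< q< =
    injectiveUpTo-append p₁ _ (xArc a) mid (xArc-injective a p₁ p₁<) mid-inj
      (λ i j i≤ j≤ → append-≢ q₁ _ (yArc c) inner (xArc a i) (λ _ _ ())
                       (append-≢ p₂ q₂ (xArc a₂) (yArc c₂) (xArc a i) (xArc-disjoint a p₁ p₂ p< i i≤) (λ _ _ ()))
                       j j≤)
    where
    a₂ c₂ : ℕ
    a₂ = a + suc p₁
    c₂ = c + suc q₁
    inner mid : ℕ → V₁ ⊎ V₂
    inner = append p₂ (xArc a₂) (yArc c₂)
    mid   = append q₁ (yArc c) inner
    p₁< : p₁ < 2 * n
    p₁< = ≤-<-trans (≤-trans (n≤1+n p₁) (m≤m+n (suc p₁) p₂)) p<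
    p₂< : p₂ < 2 * n
    p₂< = ≤-<-trans (m≤n+m p₂ (suc p₁)) p<
    q₁< : q₁ < 2 * m
    q₁< = ≤-<-trans (≤-trans (n≤1+n q₁) (m≤m+n (suc q₁) q₂)) q<
    q₂< : q₂ < 2 * m
    q₂< = ≤-<-trans (m≤n+m q₂ (suc q₁)) q<
    inner-inj : InjectiveUpTo (suc p₂ + q₂) inner
    inner-inj = injectiveUpTo-append p₂ q₂ (xArc a₂) (yArc c₂) (xArc-injective a₂ p₂ p₂<) (yArc-injective c₂ q₂ q₂<)
                  (xArc≢yArc a₂ c₂ p₂ q₂)
    mid-inj : InjectiveUpTo (suc q₁ + (suc p₂ + q₂)) mid
    mid-inj = injectiveUpTo-append q₁ _ (yArc c) inner (yArc-injective c q₁ q₁<) inner-inj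
                (λ i j i≤ j≤ → append-≢ p₂ q₂ (xArc a₂) (yArc c₂) (yArc c i) (λ _ _ ())
                                 (yArc-disjoint c q₁ q₂ q< i i≤) j j≤)

  fourArcCycle : ∀ a p₁ p₂ c q₁ q₂ → suc p₁ + p₂ < 2 * n → suc q₁ + q₂ < 2 * m →
                 DiagIs red (a + p₁ + c) → DiagIs blue (a + suc p₁ + (c + q₁)) →
                 DiagIs red (a + suc p₁ + p₂ + (c + suc q₁)) → DiagIs blue (a + (c + suc q₁ + q₂)) →
                 CycleVia (suc (suc p₁ + (suc q₁ + (suc p₂ + q₂)))) a p₁ c
  fourArcCycle a p₁ p₂ c q₁ q₂ p< q< red₁ blue₁ red₂ blue₂ =
    (λ k → W (k % suc L)) , cycle , through-ends p₁ mid L a c (s≤s (s≤s (m≤m+n p₁ _))) mid0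
    where
    a₂ c₂ L″ L′ L : ℕ
    a₂ = a + suc p₁
    c₂ = c + suc q₁
    L″ = suc p₂ + q₂
    L′ = suc q₁ + L″
    L  = suc p₁ + L′
    inner mid W : ℕ → V₁ ⊎ V₂
    inner = append p₂ (xArc a₂) (yArc c₂)
    mid   = append q₁ (yArc c) inner
    W     = fourArcs a p₁ p₂ c q₁ q₂
    inner0 : inner 0 ≡ xArc a₂ 0
    inner0 = append-≤ p₂ (xArc a₂) (yArc c₂) 0 z≤n
    mid0 : mid 0 ≡ yArc c 0
    mid0 = append-≤ q₁ (yArc c) inner 0 z≤n
    path : AltPath L W (κx a)
    path = xArc-then a p₁ c L′ mid
             (yArc-then c q₁ a₂ L″ inner (xArc-then a₂ p₂ c₂ q₂ (yArc c₂) (yArc-path c₂ q₂) refl red₂) inner0 blue₁)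
             mid0 red₁
    odd : flips L (κx a) ≡ flipC (κx a)
    odd = begin
      flips L (κx a)      ≡⟨ flips-+-≡ (suc p₁) L′ (κx a) (κy c) (proj₂ (xyJoint a p₁ c red₁)) ⟩
      flips L′ (κy c)     ≡⟨ flips-+-≡ (suc q₁) L″ (κy c) (κx a₂) (proj₂ (yxJoint a₂ c q₁ blue₁)) ⟩
      flips L″ (κx a₂)    ≡⟨ flips-+-≡ (suc p₂) q₂ (κx a₂) (κy c₂) (proj₂ (xyJoint a₂ p₂ c₂ red₂)) ⟩
      flips q₂ (κy c₂)    ≡⟨ flips-pred q₂ (κx a) (κy c₂) (proj₂ (yxJoint a c₂ q₂ blue₂)) ⟩
      flipC (κx a)        ∎
      where open ≡-Reasoning
    W-end : W L ≡ yArc c₂ q₂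
    W-end = trans (append-suc+ p₁ (xArc a) mid L′)
                  (trans (append-suc+ q₁ (yArc c) inner L″) (append-suc+ p₂ (xArc a₂) (yArc c₂) q₂))
    cycle : AltCycle (sumCol col₁ col₂ ext) (suc L) (λ k → W (k % suc L))
    cycle = closeAtX L W a c₂ q₂ path (fourArcs-injective a p₁ p₂ c q₁ q₂ p< q<)
              (s≤s (≤-trans (s≤s z≤n) (m≤n+m L′ p₁)))
              (append-≤ p₁ (xArc a) mid 0 z≤n) W-end blue₂ odd

shortArcs : ∀ n m h → n ≤ m → 2 ≤ h → h ≤ 2 * n → h ≢ n + m →
            ∃ λ p → p < 2 * n × p + 2 < 2 * m × suc (suc p + (p + 2)) ≡ h * 2
shortArcs n m h n≤m 2≤h h≤2n h≢n+m with m≤n⇒∃[o]m+o≡n 2≤h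
... | p , refl = p , ≤-trans (n≤1+n (suc p)) h≤2n , p+2< , r p
  where
  r : ∀ p → suc (suc p + (p + 2)) ≡ (2 + p) * 2
  r = solve-∀
  double : ∀ n → 2 * n ≡ n + n
  double = solve-∀
  h≢2m : 2 + p ≢ 2 * m
  h≢2m h≡2m = h≢n+m (trans h≡2m (trans (cong (2 *_) (sym n≡m)) (trans (double n) (cong (n +_) n≡m))))
    where
    n≡m : n ≡ m
    n≡m = ≤-antisym n≤m (*-cancelˡ-≤ 2 (subst (_≤ 2 * n) h≡2m h≤2n))
  p+2< : p + 2 < 2 * m
  p+2< = subst (_< 2 * m) (+-comm 2 p) (≤∧≢⇒< (≤-trans h≤2n (*-monoʳ-≤ 2 n≤m)) h≢2m)

longArcs : ∀ n m h → 2 ≤ n → n ≤ m → m ≤ h → h < n + m →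
           ∃ λ p → ∃ λ δ → n + δ ≡ m × p < 2 * n × p + (2 + 2 * δ) < 2 * m
                           × suc (suc p + (p + (2 + 2 * δ))) ≡ h * 2
longArcs n m h 2≤n n≤m m≤h h<n+m
  with m≤n⇒∃[o]m+o≡n 2≤n | m≤n⇒∃[o]m+o≡n n≤m | m≤n⇒∃[o]m+o≡n m≤h | m≤n⇒∃[o]m+o≡n h<n+m
... | n₀ , refl | δ , refl | e , refl | k , h+k≡ = e + n₀ , δ , refl , p< , p+d< , r₃ n₀ δ e
  where
  e+k≡ : e + suc k ≡ 2 + n₀
  e+k≡ = +-cancelʳ-≡ (2 + n₀ + δ) (e + suc k) (2 + n₀) (trans (r₀ n₀ δ e k) h+k≡)
    where
    r₀ : ∀ n₀ δ e k → e + suc k + (2 + n₀ + δ) ≡ suc (2 + n₀ + δ + e) + k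
    r₀ = solve-∀
  double : ∀ t → t + t ≡ 2 * t
  double = solve-∀
  p< : e + n₀ < 2 * (2 + n₀)
  p< = ≤-trans (m≤m+n (suc (e + n₀)) (2 + k))
         (≤-reflexive (trans (r₁ n₀ e k) (trans (cong (_+ (2 + n₀)) e+k≡) (double (2 + n₀)))))
    where
    r₁ : ∀ n₀ e k → suc (e + n₀) + (2 + k) ≡ e + suc k + (2 + n₀)
    r₁ = solve-∀
  p+d< : e + n₀ + (2 + 2 * δ) < 2 * (2 + n₀ + δ)
  p+d< = ≤-trans (m≤m+n (suc (e + n₀ + (2 + 2 * δ))) k)
           (≤-reflexive (trans (r₂ n₀ e k δ) (trans (cong (λ t → t + (2 + n₀) + 2 * δ) e+k≡) (r₂′ (2 + n₀) δ))))
    where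
    r₂ : ∀ n₀ e k δ → suc (e + n₀ + (2 + 2 * δ)) + k ≡ e + suc k + (2 + n₀) + 2 * δ
    r₂ = solve-∀
    r₂′ : ∀ t δ → t + t + 2 * δ ≡ 2 * (t + δ)
    r₂′ = solve-∀
  r₃ : ∀ n₀ δ e → suc (suc (e + n₀) + (e + n₀ + (2 + 2 * δ))) ≡ (2 + n₀ + δ + e) * 2
  r₃ = solve-∀

hamiltonianArcs : ∀ {n m} u m₀ n₀ → 2 + n₀ ≡ n → m ≡ u + 2 + m₀ →
                  2 + (2 * n₀ + 1) < 2 * n × suc (2 * m₀ + 1) + (2 * u + 1) < 2 * m
                  × suc (suc 1 + (suc (2 * m₀ + 1) + (suc (2 * n₀ + 1) + (2 * u + 1)))) ≡ 2 * n + 2 * m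
hamiltonianArcs u m₀ n₀ refl refl = ≤-reflexive (r₁ n₀) , ≤-reflexive (r₂ u m₀) , r₃ u m₀ n₀
  where
  r₁ : ∀ n₀ → suc (2 + (2 * n₀ + 1)) ≡ 2 * (2 + n₀)
  r₁ = solve-∀
  r₂ : ∀ u m₀ → suc (suc (2 * m₀ + 1) + (2 * u + 1)) ≡ 2 * (u + 2 + m₀)
  r₂ = solve-∀
  r₃ : ∀ u m₀ n₀ → suc (suc 1 + (suc (2 * m₀ + 1) + (suc (2 * n₀ + 1) + (2 * u + 1)))) ≡ 2 * (2 + n₀) + 2 * (u + 2 + m₀)
  r₃ = solve-∀

-- The remaining three diagonal positions of the Hamiltonian cycle, given the first.
hamiltonianPositions : ∀ {n m} s u m₀ n₀ a c X Y → 2 + n₀ ≡ n → m ≡ u + 2 + m₀ → a + 1 + c ≡ s + 2 * u + 4 + X + Y →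
                         a + 2 + (c + (2 * m₀ + 1)) ≡ s + 2 + X + (2 * m + Y)
                       × a + 2 + (2 * n₀ + 1) + (c + suc (2 * m₀ + 1)) ≡ s + (2 * n + X) + (2 * m + Y)
                       × a + (c + suc (2 * m₀ + 1) + (2 * u + 1)) ≡ s + 2 * u + 2 + X + (2 * m + Y)
hamiltonianPositions s u m₀ n₀ a c X Y refl refl shift =
  trans (r₁ a c m₀) (trans (cong (_+ (2 * m₀ + 2)) shift) (r₂ s u m₀ X Y)) ,
  trans (r₃ a c n₀ m₀) (trans (cong (_+ (2 * n₀ + 2 * m₀ + 4)) shift) (r₄ s u n₀ m₀ X Y)) ,
  trans (r₅ a c m₀ u) (trans (cong (_+ (2 * m₀ + 2 * u + 2)) shift) (r₆ s u m₀ X Y))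
  where
  r₁ : ∀ a c m₀ → a + 2 + (c + (2 * m₀ + 1)) ≡ a + 1 + c + (2 * m₀ + 2)
  r₁ = solve-∀
  r₂ : ∀ s u m₀ X Y → s + 2 * u + 4 + X + Y + (2 * m₀ + 2) ≡ s + 2 + X + (2 * (u + 2 + m₀) + Y)
  r₂ = solve-∀
  r₃ : ∀ a c n₀ m₀ → a + 2 + (2 * n₀ + 1) + (c + suc (2 * m₀ + 1)) ≡ a + 1 + c + (2 * n₀ + 2 * m₀ + 4)
  r₃ = solve-∀
  r₄ : ∀ s u n₀ m₀ X Y → s + 2 * u + 4 + X + Y + (2 * n₀ + 2 * m₀ + 4) ≡ s + (2 * (2 + n₀) + X) + (2 * (u + 2 + m₀) + Y)
  r₄ = solve-∀
  r₅ : ∀ a c m₀ u → a + (c + suc (2 * m₀ + 1) + (2 * u + 1)) ≡ a + 1 + c + (2 * m₀ + 2 * u + 2)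
  r₅ = solve-∀
  r₆ : ∀ s u m₀ X Y → s + 2 * u + 4 + X + Y + (2 * m₀ + 2 * u + 2) ≡ s + 2 * u + 2 + X + (2 * (u + 2 + m₀) + Y)
  r₆ = solve-∀

module Lengths {V₁ V₂ : Set} {col₁ : Coloring V₁} {col₂ : Coloring V₂}
  (C : CyclePair col₁ col₂) (ext : V₁ → V₂ → Color) (rigid : Rigid C ext) where

  open Diagonal C ext rigid
  open ArcCycles C ext rigid

  G : Coloring (V₁ ⊎ V₂)
  G = sumCol col₁ col₂ ext

  -- Starting positions a, c of the arcs, chosen so that the cycle meets v, at the
  -- cost of shifting the diagonal position b by whole periods.
  record Anchor (v : V₁ ⊎ V₂) (o b : ℕ) : Set where
    field
      a c K₁ K₂ : ℕ
      shift : a + o + c ≡ b + K₁ * (2 * n) + K₂ * (2 * m)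
      meets : ∀ p (w : ℕ → V₁ ⊎ V₂) → w 0 ≡ inj₁ (x a) → w (suc p) ≡ inj₂ (y c) → PassesThrough w v

  anchor : ∀ v o b → Anchor v o b
  anchor (inj₁ u) o b = record
    { a = i ; c = T ∸ (i + o) ; K₁ = i + o ; K₂ = 0 ; shift = m+[n∸m]≡n i+o≤T
    ; meets = λ p w w0 _ → 0 , trans w0 (cong inj₁ (proj₂ (covX u))) }
    where
    i T : ℕ
    i = proj₁ (covX u)
    T = b + (i + o) * (2 * n) + 0 * (2 * m)
    i+o≤T : i + o ≤ T
    i+o≤T = ≤-trans (≤-trans (m≤m*n (i + o) (2 * n)) (m≤n+m _ b)) (m≤m+n _ 0)
  anchor (inj₂ w′) o b = record
    { a = T ∸ (o + j) ; c = j ; K₁ = 0 ; K₂ = o + j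
    ; shift = trans (+-assoc (T ∸ (o + j)) o j) (m∸n+n≡m o+j≤T)
    ; meets = λ p w _ wp → suc p , trans wp (cong inj₂ (proj₂ (covY w′))) }
    where
    j T : ℕ
    j = proj₁ (covY w′)
    T = b + 0 * (2 * n) + (o + j) * (2 * m)
    o+j≤T : o + j ≤ T
    o+j≤T = ≤-trans (m≤m*n (o + j) (2 * m)) (m≤n+m _ (b + 0 * (2 * n)))

  twoArcCycleThrough : ∀ v p d b → p < 2 * n → p + d < 2 * m → 1 ≤ d →
                       DiagIs red b → DiagIs blue (b + d) → AltCycleThrough G (suc (suc p + (p + d))) v
  twoArcCycleThrough v p d b p< p+d< 1≤d red₀ blue₀ =
    let (w , cycle , w0 , wp) = twoArcCycle a p c (p + d) p< p+d< (≤-trans 1≤d (≤-trans (m≤n+m d p) (m≤n+m (p + d) p)))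
                                  (diagIs-shift K₁ K₂ red₀ shift) (diagIs-shift K₁ K₂ blue₀ blue-shift)
    in w , cycle , meets p w w0 wp
    where
    open Anchor (anchor v p b)
    rearrange₁ : ∀ a p c d → a + (c + (p + d)) ≡ a + p + c + d
    rearrange₁ = solve-∀
    rearrange₂ : ∀ b d X Y → b + X + Y + d ≡ b + d + X + Y
    rearrange₂ = solve-∀
    blue-shift : a + (c + (p + d)) ≡ b + d + K₁ * (2 * n) + K₂ * (2 * m)
    blue-shift = trans (rearrange₁ a p c d) (trans (cong (_+ d) shift) (rearrange₂ b d (K₁ * (2 * n)) (K₂ * (2 * m))))

  -- Four arcs of lengths 1, 2n - 3, 2m - 2u - 3 and 2u + 1 use every vertex.
  hamiltonianCycleThrough : Switch → ∀ v → AltCycleThrough G (2 * n + 2 * m) v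
  hamiltonianCycleThrough sw v with m≤n⇒∃[o]m+o≡n n≥2
  ... | n₀ , 2+n₀≡n =
    let (e₂ , e₃ , e₄) = hamiltonianPositions s u m₀ n₀ a c (K₁ * (2 * n)) (K₂ * (2 * m)) 2+n₀≡n m≡ shift
        (p< , q< , length≡) = hamiltonianArcs u m₀ n₀ 2+n₀≡n m≡
        (w , cycle , w0 , wp) = fourArcCycle a 1 (2 * n₀ + 1) c (2 * m₀ + 1) (2 * u + 1) p< q<
                                  (diagIs-shift K₁ K₂ red₁ shift) (diagIs-shift K₁ (suc K₂) blue₀ e₂)
                                  (diagIs-shift (suc K₁) (suc K₂) red₀ e₃) (diagIs-shift K₁ (suc K₂) blue₁ e₄)
    in subst (λ ℓ → AltCycleThrough G ℓ v) length≡ (w , cycle , meets 1 w w0 wp)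
    where
    open Switch sw
    open Anchor (anchor v 1 (s + 2 * u + 4))

  module _ {s : ℕ} (red₀ : DiagIs red s) (blue₀ : DiagIs blue (s + 2)) (n≤m : n ≤ m) where

    shortCycleThrough : ∀ v h → 2 ≤ h → h ≤ 2 * n → h ≢ n + m → AltCycleThrough G (h * 2) v
    shortCycleThrough v h 2≤h h≤2n h≢n+m =
      let (p , p< , p+2< , length≡) = shortArcs n m h n≤m 2≤h h≤2n h≢n+m
      in subst (λ ℓ → AltCycleThrough G ℓ v) length≡ (twoArcCycleThrough v p 2 s p< p+2< (s≤s z≤n) red₀ blue₀)

    -- diag is blue at s + 2 + 2δ because s + 2 + 2δ + 2n = s + 2 + 2m.
    longCycleThrough : ∀ v h → m ≤ h → h < n + m → AltCycleThrough G (h * 2) v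
    longCycleThrough v h m≤h h<n+m =
      let (p , δ , n+δ≡m , p< , p+d< , length≡) = longArcs n m h n≥2 n≤m m≤h h<n+m
      in subst (λ ℓ → AltCycleThrough G ℓ v) length≡
               (twoArcCycleThrough v p (2 + 2 * δ) s p< p+d< (s≤s z≤n) red₀ (blue-at δ n+δ≡m))
      where
      blue-at : ∀ δ → n + δ ≡ m → DiagIs blue (s + (2 + 2 * δ))
      blue-at δ n+δ≡m = opposed , trans (diag-≡-+periods 1 0 0 1 opposed (proj₁ blue₀) positions) (proj₂ blue₀)
        where
        r : ∀ δ → 2 * (1 + δ) ≡ 2 + 2 * δ
        r = solve-∀
        opposed : Opposed (s + (2 + 2 * δ)) 0
        opposed = subst (λ t → Opposed (s + t) 0) (r δ) (opposed-+even s (1 + δ) (proj₁ red₀))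
        r′ : ∀ s δ n → s + (2 + 2 * δ) + 1 * (2 * n) + 0 * (2 * (n + δ)) ≡ s + 2 + 0 * (2 * n) + 1 * (2 * (n + δ))
        r′ = solve-∀
        positions : s + (2 + 2 * δ) + 1 * (2 * n) + 0 * (2 * m) ≡ s + 2 + 0 * (2 * n) + 1 * (2 * m)
        positions = subst (λ t → s + (2 + 2 * δ) + 1 * (2 * n) + 0 * (2 * t) ≡ s + 2 + 0 * (2 * n) + 1 * (2 * t))
                          n+δ≡m (r′ s δ n)

  module _ (sw : Switch) (n≤m : n ≤ m) where

    open Switch sw

    cycleThrough : ∀ v h → (2 ≤ h × h ≤ 2 * n) ⊎ (m ≤ h × h ≤ n + m) → AltCycleThrough G (h * 2) v
    cycleThrough v h range with h ≟ n + m | h ≤? 2 * n | range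
    ... | yes h≡n+m | _        | _                  =
      subst (λ ℓ → AltCycleThrough G ℓ v) (sym (trans (cong (_* 2) h≡n+m) (r n m))) (hamiltonianCycleThrough sw v)
      where
      r : ∀ n m → (n + m) * 2 ≡ 2 * n + 2 * m
      r = solve-∀
    ... | no h≢n+m  | yes h≤2n | inj₁ (2≤h , _)     =
      shortCycleThrough red₀ blue₀ n≤m v h 2≤h h≤2n h≢n+m
    ... | no h≢n+m  | yes h≤2n | inj₂ (m≤h , _)     =
      shortCycleThrough red₀ blue₀ n≤m v h (≤-trans m≥2 m≤h) h≤2n h≢n+m
    ... | no _      | no h≰2n  | inj₁ (_ , h≤2n)    = ⊥-elim (h≰2n h≤2n)
    ... | no h≢n+m  | no _     | inj₂ (m≤h , h≤n+m) =
      longCycleThrough red₀ blue₀ n≤m v h m≤h (≤∧≢⇒< h≤n+m h≢n+m)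

module Swap {V₁ V₂ : Set} {col₁ : Coloring V₁} {col₂ : Coloring V₂}
  (C : CyclePair col₁ col₂) (ext : V₁ → V₂ → Color) where

  open Exterior C ext

  ext⁻ : V₂ → V₁ → Color
  ext⁻ w v = ext v w

  swapPair : CyclePair col₂ col₁
  swapPair = record
    { n = m ; m = n ; n≥2 = m≥2 ; m≥2 = n≥2 ; x = y ; y = x ; perX = perY ; perY = perX
    ; distX = distY ; distY = distX ; κx = κy ; κy = κx ; colX = colY ; colY = colX
    ; κx-alt = κy-alt ; κy-alt = κx-alt ; covX = covY ; covY = covX }

  swapPair-rigid : Rigid C ext → Rigid swapPair ext⁻
  swapPair-rigid rigid j i κ≡ =
    let (parallel , crossed) = rigid i j (sym κ≡)
    in parallel , trans (sym (flipC-involutive _)) (cong flipC (sym crossed))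

  swapPair-nonconstant : OpposedNonconstant → Exterior.OpposedNonconstant swapPair ext⁻
  swapPair-nonconstant (i₁ , j₁ , i₂ , j₂ , o₁ , o₂ , rel≢) =
    j₁ , i₁ , j₂ , i₂ , swap-opposed o₁ , swap-opposed o₂ ,
    λ e → rel≢ (flipC-injective (trans (sym (rel-as-relY o₁)) (trans e (rel-as-relY o₂))))
    where
    swap-opposed : ∀ {i j} → Opposed i j → κx i ≡ flipC (κy j)
    swap-opposed o = trans (sym (flipC-involutive _)) (cong flipC (sym o))
    rel-as-relY : ∀ {i j} → Opposed i j → relColor (E i j) (κy j) ≡ flipC (rel i j)
    rel-as-relY {i} {j} o = trans (cong (relColor (E i j)) o) (relColor-flipCʳ (E i j) (κx i))

  sumCol-swap : ∀ u v → sumCol col₁ col₂ ext (swap u) (swap v) ≡ sumCol col₂ col₁ ext⁻ u v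
  sumCol-swap (inj₁ _) (inj₁ _) = refl
  sumCol-swap (inj₁ _) (inj₂ _) = refl
  sumCol-swap (inj₂ _) (inj₁ _) = refl
  sumCol-swap (inj₂ _) (inj₂ _) = refl

  altCycleThrough-swap : ∀ ℓ v → AltCycleThrough (sumCol col₂ col₁ ext⁻) ℓ (swap v) →
                         AltCycleThrough (sumCol col₁ col₂ ext) ℓ v
  altCycleThrough-swap ℓ v (w , cycle , k , wk≡) =
    (λ i → swap (w i)) , swapped , k , trans (cong swap wk≡) (swap-involutive v)
    where
    open AltCycle cycle
    swapped : AltCycle (sumCol col₁ col₂ ext) ℓ (λ i → swap (w i))
    swapped = record
      { long     = long
      ; periodic = λ i → cong swap (periodic i)
      ; distinct = λ i j i< j< e → distinct i j i< j< (trans (sym (swap-involutive (w i))) (trans (cong swap e) (swap-involutive (w j))))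
      ; alt      = λ i → let (c , e₁ , e₂) = alt i in
                         c , trans (sumCol-swap (w i) (w (suc i))) e₁ , trans (sumCol-swap (w (suc i)) (w (suc (suc i)))) e₂
      }

LengthRange : ℕ → ℕ → ℕ → Set
LengthRange n m h = (2 ≤ h × h ≤ 2 * (n ⊓ m)) ⊎ (n ⊔ m ≤ h × h ≤ n + m)

lengthRange-comm : ∀ n m h → LengthRange n m h → LengthRange m n h
lengthRange-comm n m h (inj₁ (2≤h , h≤)) = inj₁ (2≤h , subst (λ t → h ≤ 2 * t) (⊓-comm n m) h≤)
lengthRange-comm n m h (inj₂ (≤h , h≤)) = inj₂ (subst (_≤ h) (⊔-comm n m) ≤h , subst (h ≤_) (+-comm n m) h≤)

lengthRange-≤ : ∀ {n m h} → n ≤ m → LengthRange n m h → (2 ≤ h × h ≤ 2 * n) ⊎ (m ≤ h × h ≤ n + m)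
lengthRange-≤ n≤m (inj₁ (2≤h , h≤)) = inj₁ (2≤h , subst (λ t → _ ≤ 2 * t) (m≤n⇒m⊓n≡m n≤m) h≤)
lengthRange-≤ n≤m (inj₂ (≤h , h≤)) = inj₂ (subst (_≤ _) (m≤n⇒m⊔n≡n n≤m) ≤h , h≤)

halve-lengthRange : ∀ n m h → (4 ≤ h * 2 × h * 2 ≤ 4 * (n ⊓ m)) ⊎ (2 * (n ⊔ m) ≤ h * 2 × h * 2 ≤ 2 * n + 2 * m) →
                    LengthRange n m h
halve-lengthRange n m h (inj₁ (4≤ , ≤4k)) =
  inj₁ (*-cancelʳ-≤ 2 h 2 4≤ , *-cancelʳ-≤ h (2 * (n ⊓ m)) 2 (subst (h * 2 ≤_) (r (n ⊓ m)) ≤4k))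
  where
  r : ∀ k → 4 * k ≡ (2 * k) * 2
  r = solve-∀
halve-lengthRange n m h (inj₂ (2k≤ , ≤2n+2m)) =
  inj₂ (*-cancelʳ-≤ (n ⊔ m) h 2 (subst (_≤ h * 2) (*-comm 2 (n ⊔ m)) 2k≤) ,
        *-cancelʳ-≤ h (n + m) 2 (subst (h * 2 ≤_) (r n m) ≤2n+2m))
  where
  r : ∀ n m → 2 * n + 2 * m ≡ (n + m) * 2
  r = solve-∀

opposedCycles : {V₁ V₂ : Set} {col₁ : Coloring V₁} {col₂ : Coloring V₂} (C : CyclePair col₁ col₂)
                (ext : V₁ → V₂ → Color) → Rigid C ext → Exterior.OpposedNonconstant C ext →
                ∀ v h → LengthRange (CyclePair.n C) (CyclePair.m C) h →
                AltCycleThrough (sumCol col₁ col₂ ext) (h * 2) v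
opposedCycles C ext rigid nc v h range with CyclePair.n C ≤? CyclePair.m C
... | yes n≤m = Lengths.cycleThrough C ext rigid (Diagonal.nonconstant⇒switch C ext rigid nc) n≤m v h (lengthRange-≤ n≤m range)
... | no n≰m  =
  altCycleThrough-swap C ext (h * 2) v
    (Lengths.cycleThrough (swapPair C ext) (ext⁻ C ext) rigid′
       (Diagonal.nonconstant⇒switch (swapPair C ext) (ext⁻ C ext) rigid′ (swapPair-nonconstant C ext nc))
       (≰⇒≥ n≰m) (swap v) h (lengthRange-≤ (≰⇒≥ n≰m) (lengthRange-comm (CyclePair.n C) (CyclePair.m C) h range)))
  where
  open Swap
  rigid′ : Rigid (swapPair C ext) (ext⁻ C ext)
  rigid′ = swapPair-rigid C ext rigid

cyclesOfAllLengths : {V₁ V₂ : Set} {col₁ : Coloring V₁} {col₂ : Coloring V₂} (C : CyclePair col₁ col₂)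
                     (ext : V₁ → V₂ → Color) → (∀ u w → col₂ u w ≡ col₂ w u) → Rigid C ext →
                     Exterior.OpposedNonconstant C ext ⊎ Exterior.AlignedNonconstant C ext →
                     ∀ v h → LengthRange (CyclePair.n C) (CyclePair.m C) h →
                     AltCycleThrough (sumCol col₁ col₂ ext) (h * 2) v
cyclesOfAllLengths C ext symm₂ rigid (inj₁ opposed) = opposedCycles C ext rigid opposed
cyclesOfAllLengths C ext symm₂ rigid (inj₂ aligned) =
  opposedCycles (reverseY C ext symm₂) ext (reverseY-rigid C ext symm₂ rigid) (aligned⇒opposed C ext symm₂ aligned)
  where open Reversal

mainTheorem3 : {V₁ V₂ : Set} (col₁ : Coloring V₁) (col₂ : Coloring V₂)
    → IsSimple col₁ → IsSimple col₂
    → (n m : ℕ) (x : ℕ → V₁) (y : ℕ → V₂)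
    → HamAltCycle col₁ (2 * n) x → HamAltCycle col₂ (2 * m) y
    → (ext : V₁ → V₂ → Color)
    → NoGoodPair col₁ col₂ ext (2 * n) x (2 * m) y
    → (∃ λ (v : V₁) → NonSingular ext v)
    → (∃ λ (w : V₂) → NonSingular (λ a b → ext b a) w)
    → ∀ (v : V₁ ⊎ V₂) (ℓ : ℕ) → 2 ∣ ℓ
    → (4 ≤ ℓ × ℓ ≤ 4 * (n ⊓ m)) ⊎ (2 * (n ⊔ m) ≤ ℓ × ℓ ≤ 2 * n + 2 * m)
    → ∃ λ (w : ℕ → V₁ ⊎ V₂) → AltCycle (sumCol col₁ col₂ ext) ℓ w × PassesThrough w v
mainTheorem3 col₁ col₂ _ simple₂ n m x y H₁ H₂ ext noGood nonsingX nonsingY v ℓ (divides h refl) range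
  with hamAltCycles⇒cyclePair col₁ col₂ n m x y H₁ H₂
... | C , refl , refl , refl , refl =
  cyclesOfAllLengths C ext (IsSimple.symm simple₂) (noGoodPair⇒rigid C ext noGood)
    (Nonsingular.nonsingular⇒nonconstant C ext nonsingX nonsingY) v h (halve-lengthRange (CyclePair.n C) (CyclePair.m C) h range)
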